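{- Let $\langle w\rangle$ be a square-free circular word over $V(D)$ that is walkable in the digraph $D$, and let $W\in\delta'(w)$. Then the circular word $\langle W\rangle$ is square-free.
   Context: Let $\Gamma=\{\mathtt{a},\mathtt{b},\mathtt{c}\}$ and let $\mathbb{S}_\Gamma$ be the six permutations of $\Gamma$ in cycle notation: $()$ (identity), $(\mathtt{ab})$, $(\mathtt{ac})$, $(\mathtt{bc})$, $(\mathtt{abc})$ (mapping $\mathtt{a}\mapsto\mathtt{b}\mapsto\mathtt{c}\mapsto\mathtt{a}$), $(\mathtt{acb})$. For each $\pi$ let $\tilde\pi$ be a new symbol, $\widetilde{\mathbb{S}}_\Gamma=\{\tilde\pi\}$. The digraph $D$ has vertex set $V(D)=\mathbb{S}_\Gamma\cup\widetilde{\mathbb{S}}_\Gamma$ and exactly the 24 arcs: $()\to\widetilde{(\mathtt{ab})}$, $()\to(\mathtt{bc})$; $(\mathtt{ab})\to\widetilde{()}$, $(\mathtt{ab})\to(\mathtt{abc})$; $(\mathtt{ac})\to\widetilde{(\mathtt{abc})}$, $(\mathtt{ac})\to(\mathtt{acb})$; $(\mathtt{bc})\to\widetilde{(\mathtt{acb})}$, $(\mathtt{bc})\to()$; $(\mathtt{abc})\to\widetilde{(\mathtt{ac})}$, $(\mathtt{abc})\to(\mathtt{ab})$; $(\mathtt{acb})\to\widetilde{(\mathtt{bc})}$, $(\mathtt{acb})\to(\mathtt{ac})$; $\widetilde{()}\to(\mathtt{ac})$, $\widetilde{()}\to\widetilde{(\mathtt{bc})}$; $\widetilde{(\mathtt{ab})}\to(\mathtt{acb})$,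 $\widetilde{(\mathtt{ab})}\to\widetilde{(\mathtt{abc})}$; $\widetilde{(\mathtt{ac})}\to()$, $\widetilde{(\mathtt{ac})}\to\widetilde{(\mathtt{acb})}$; $\widetilde{(\mathtt{bc})}\to(\mathtt{abc})$, $\widetilde{(\mathtt{bc})}\to\widetilde{()}$; $\widetilde{(\mathtt{abc})}\to(\mathtt{bc})$, $\widetilde{(\mathtt{abc})}\to\widetilde{(\mathtt{ab})}$; $\widetilde{(\mathtt{acb})}\to(\mathtt{ab})$, $\widetilde{(\mathtt{acb})}\to\widetilde{(\mathtt{ac})}$. For a word $N$ over $\Gamma$ and $\pi\in\mathbb{S}_\Gamma$, $N_\pi$ is obtained by applying $\pi$ letterwise, and $N_{\tilde\pi}$ is the reversal of $N_\pi$. Let $Q=\mathtt{abacbabcacbacabacbcacbacabcbabcabacbcabcb}$, $R=\mathtt{abacabcacbacabcbabcacbacabacbcacbacabcbabcabacbcabcb}$, $Q'=\mathtt{abacabcacbacabcbabcacbacabacbcacbacabcbacbcabacbabcabacbcabcb}$, $R'=\mathtt{abacabcacbacabcbabcacbacabacbcacbacabcbabcacbcabacbabcabacbcabcb}$. The substitution $\delta':V(D)^*\to 2^{\Gamma^*}$ is given on letters by $\delta'(x)=\{Q_x,R_x,Q'_x,R'_x\}$ and on words by $\delta'(a_1\cdots a_n)=\{A_1\cdots A_n:A_i\in\delta'(a_i)\}$. A word is square-free if it has no factor $yy$ with $y$ nonempty. The circular word $\langle w\rangle$ is the set of all conjugates (cyclic shifts) of $w$; it is square-free if every conjugate is square-free.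 For $w=w_0\cdots w_{n-1}$ over $V(D)$, $\langle w\rangle$ is walkable in $D$ if there is an arc from $w_i$ to $w_{i+1}$ for every $i$, indices modulo $n$. -}

module Defs where

open import Data.Unit using (⊤)
open import Data.List using (List; []; _∷_; _++_; map; reverse; length)
open import Data.List.Membership.Propositional using (_∈_)
open import Data.Product using (_×_)
open import Relation.Binary.PropositionalEquality using (_≡_)
open import Relation.Nullary using (¬_)

data Γ : Set where
  a b c : Γ

-- The six permutations of Γ (cycle notation)
data Perm : Set where
  id ab ac bc abc acb : Perm

act : Perm → Γ → Γ
act id  x = x
act ab  a = b
act ab  b = a
act ab  c = c
act ac  a = c
act ac  b = b
act ac  c = a
act bc  a = a
act bc  b = c
act bc  c = b
act abc a = b
act abc b = c
act abc c = a
act acb a = c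
act acb b = a
act acb c = b

-- vertices of D : S_Γ ∪ S̃_Γ
data V : Set where
  pl  : Perm → V
  tl  : Perm → V

succs : V → List V
succs (pl id)  = tl ab ∷ pl bc ∷ []
succs (pl ab)  = tl id ∷ pl abc ∷ []
succs (pl ac)  = tl abc ∷ pl acb ∷ []
succs (pl bc)  = tl acb ∷ pl id ∷ []
succs (pl abc) = tl ac ∷ pl ab ∷ []
succs (pl acb) = tl bc ∷ pl ac ∷ []
succs (tl id)  = pl ac ∷ tl bc ∷ []
succs (tl ab)  = pl acb ∷ tl abc ∷ []
succs (tl ac)  = pl id ∷ tl acb ∷ []
succs (tl bc)  = pl abc ∷ tl id ∷ []
succs (tl abc) = pl bc ∷ tl ab ∷ []
succs (tl acb) = pl ab ∷ tl ac ∷ []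

Arc : V → V → Set
Arc x y = y ∈ succs x

Word : Set
Word = List Γ

image : V → Word → Word
image (pl π) N = map (act π) N
image (tl π) N = reverse (map (act π) N)

Q : Word
Q = a ∷ b ∷ a ∷ c ∷ b ∷ a ∷ b ∷ c ∷ a ∷ c ∷ b ∷ a ∷ c ∷ a ∷ b ∷ a ∷ c ∷ b ∷ c ∷ a ∷ c ∷ b ∷ a ∷ c ∷ a ∷ b ∷ c ∷ b ∷ a ∷ b ∷ c ∷ a ∷ b ∷ a ∷ c ∷ b ∷ c ∷ a ∷ b ∷ c ∷ b ∷ []

R : Word
R = a ∷ b ∷ a ∷ c ∷ a ∷ b ∷ c ∷ a ∷ c ∷ b ∷ a ∷ c ∷ a ∷ b ∷ c ∷ b ∷ a ∷ b ∷ c ∷ a ∷ c ∷ b ∷ a ∷ c ∷ a ∷ b ∷ a ∷ c ∷ b ∷ c ∷ a ∷ c ∷ b ∷ a ∷ c ∷ a ∷ b ∷ c ∷ b ∷ a ∷ b ∷ c ∷ a ∷ b ∷ a ∷ c ∷ b ∷ c ∷ a ∷ b ∷ c ∷ b ∷ []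

Q' : Word
Q' = a ∷ b ∷ a ∷ c ∷ a ∷ b ∷ c ∷ a ∷ c ∷ b ∷ a ∷ c ∷ a ∷ b ∷ c ∷ b ∷ a ∷ b ∷ c ∷ a ∷ c ∷ b ∷ a ∷ c ∷ a ∷ b ∷ a ∷ c ∷ b ∷ c ∷ a ∷ c ∷ b ∷ a ∷ c ∷ a ∷ b ∷ c ∷ b ∷ a ∷ c ∷ b ∷ c ∷ a ∷ b ∷ a ∷ c ∷ b ∷ a ∷ b ∷ c ∷ a ∷ b ∷ a ∷ c ∷ b ∷ c ∷ a ∷ b ∷ c ∷ b ∷ []

R' : Word
R' = a ∷ b ∷ a ∷ c ∷ a ∷ b ∷ c ∷ a ∷ c ∷ b ∷ a ∷ c ∷ a ∷ b ∷ c ∷ b ∷ a ∷ b ∷ c ∷ a ∷ c ∷ b ∷ a ∷ c ∷ a ∷ b ∷ a ∷ c ∷ b ∷ c ∷ a ∷ c ∷ b ∷ a ∷ c ∷ a ∷ b ∷ c ∷ b ∷ a ∷ b ∷ c ∷ a ∷ c ∷ b ∷ c ∷ a ∷ b ∷ a ∷ c ∷ b ∷ a ∷ b ∷ c ∷ a ∷ b ∷ a ∷ c ∷ b ∷ c ∷ a ∷ b ∷ c ∷ b ∷ []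

data InDeltaLetter (x : V) : Word → Set where
  useQ  : InDeltaLetter x (image x Q)
  useR  : InDeltaLetter x (image x R)
  useQ' : InDeltaLetter x (image x Q')
  useR' : InDeltaLetter x (image x R')

data InDelta : List V → Word → Set where
  []  : InDelta [] []
  _∷_ : ∀ {x xs A W} → InDeltaLetter x A → InDelta xs W → InDelta (x ∷ xs) (A ++ W)

SquareFree : {A : Set} → List A → Set
SquareFree {A} w = ∀ (x y z : List A) → ¬ (y ≡ []) → ¬ (w ≡ x ++ y ++ y ++ z)

CircSquareFree : {A : Set} → List A → Set
CircSquareFree {A} w = ∀ (u v : List A) → w ≡ u ++ v → SquareFree (v ++ u)

-- ⟨w⟩ walkable in D: arc from w_i to w_{i+1} for all i, indices modulo n = |w|.
-- ChainTo x₀ y ys : arcs y→ys₀→ys₁→…→(last)→x₀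
ChainTo : V → V → List V → Set
ChainTo x₀ y []       = Arc y x₀
ChainTo x₀ y (z ∷ zs) = Arc y z × ChainTo x₀ z zs

Walkable : List V → Set
Walkable []       = ⊤
Walkable (x ∷ xs) = ChainTo x x xs

module Submission where

open import Defs
open import Data.List using (List; []; _∷_; _++_)
open import Data.List.Properties using (++-conicalˡ; ++-conicalʳ)
open import Data.Nat using (z≤n; s≤s)
open import Data.Empty using (⊥-elim)
open import Relation.Binary.PropositionalEquality using (sym; cong₂; subst)

-- Every block of W ∈ δ'(w) is a word of length 41 to 65.  A square yy in a conjugate of W is a
-- square of W W W starting in one of the first two copies.  If |y| ≤ 41 it lies inside three
-- consecutive blocks whose vertices form a walk in D, and an exhaustive check over all such walks
-- finds no square of period at most 41.  If |y| ≥ 42, the check that certain windows (the last d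
-- letters of a block followed by the first e letters of a block) occur inside blocks only at
-- block boundaries makes the block boundaries inside the first y reappear, shifted by |y|, inside
-- the second y.  The blocks strictly between them coincide, a block word determines its vertex,
-- and every block is determined by its prefix or its suffix at the boundary where the square
-- starts; so the vertices repeat with a period of at most |w|/2, giving a square in a conjugate
-- of w.

module Positions where

  open import Data.Nat using (ℕ; zero; suc; _+_; _∸_; _≤_; _<_; z≤n; s≤s)
  open import Data.Nat.Properties
  open import Data.List using (List; []; _∷_; _++_; map; length; take; drop)
  open import Data.List.Properties using (length-++; length-take; length-drop; ++-assoc)
  open import Data.Maybe using (Maybe; just; nothing)
  import Data.Maybe as Maybe
  open import Data.Product using (Σ; _,_)
  open import Relation.Nullary using (yes; no)
  open import Relation.Binary.PropositionalEquality
  open ≡-Reasoning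

  private variable A B : Set

  lastN : ℕ → List A → List A
  lastN n xs = drop (length xs ∸ n) xs

  infixl 9 _!?_
  _!?_ : List A → ℕ → Maybe A
  []       !? _     = nothing
  (x ∷ xs) !? zero  = just x
  (x ∷ xs) !? suc i = xs !? i

  !?-++ˡ : (xs ys : List A) {i : ℕ} → i < length xs → (xs ++ ys) !? i ≡ xs !? i
  !?-++ˡ (x ∷ xs) ys {zero}  _       = refl
  !?-++ˡ (x ∷ xs) ys {suc i} (s≤s p) = !?-++ˡ xs ys p

  !?-++ʳ : (xs ys : List A) (i : ℕ) → (xs ++ ys) !? (length xs + i) ≡ ys !? i
  !?-++ʳ []       ys i = refl
  !?-++ʳ (x ∷ xs) ys i = !?-++ʳ xs ys i

  !?-drop : (xs : List A) (k i : ℕ) → drop k xs !? i ≡ xs !? (k + i)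
  !?-drop xs       zero    i = refl
  !?-drop []       (suc k) i = refl
  !?-drop (x ∷ xs) (suc k) i = !?-drop xs k i

  !?-take : (xs : List A) {k i : ℕ} → i < k → take k xs !? i ≡ xs !? i
  !?-take []       {suc k}         _       = refl
  !?-take (x ∷ xs) {suc k} {zero}  _       = refl
  !?-take (x ∷ xs) {suc k} {suc i} (s≤s p) = !?-take xs p

  !?-map : (f : A → B) (xs : List A) (i : ℕ) → map f xs !? i ≡ Maybe.map f (xs !? i)
  !?-map f []       i       = refl
  !?-map f (x ∷ xs) zero    = refl
  !?-map f (x ∷ xs) (suc i) = !?-map f xs i

  !?-defined : (xs : List A) {i : ℕ} → i < length xs → Σ A λ x → xs !? i ≡ just x
  !?-defined (x ∷ xs) {zero}  _       = x , refl
  !?-defined (x ∷ xs) {suc i} (s≤s p) = !?-defined xs p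

  !?-just⇒< : (xs : List A) (i : ℕ) {x : A} → xs !? i ≡ just x → i < length xs
  !?-just⇒< (x ∷ xs) zero    _ = s≤s z≤n
  !?-just⇒< (x ∷ xs) (suc i) e = s≤s (!?-just⇒< xs i e)

  !?-extensionality : (xs ys : List A) → length xs ≡ length ys →
                      (∀ i → i < length xs → xs !? i ≡ ys !? i) → xs ≡ ys
  !?-extensionality []       []       _ _ = refl
  !?-extensionality (x ∷ xs) (y ∷ ys) l f with f 0 (s≤s z≤n)
  ... | refl = cong (x ∷_) (!?-extensionality xs ys (suc-injective l) (λ i p → f (suc i) (s≤s p)))

  Occurs : List A → List A → ℕ → Set
  Occurs X U p = ∀ t → t < length X → U !? (p + t) ≡ X !? t

  occurs-unique : (X Y U : List A) (p : ℕ) → length X ≡ length Y → Occurs X U p → Occurs Y U p → X ≡ Y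
  occurs-unique X Y U p l oX oY =
    !?-extensionality X Y l (λ i i< → trans (sym (oX i i<)) (oY i (subst (i <_) l i<)))

  occurs-[] : (U : List A) (p : ℕ) → Occurs [] U p
  occurs-[] U p t ()

  occurs-++ : (X Y U : List A) (p : ℕ) → Occurs X U p → Occurs Y U (p + length X) → Occurs (X ++ Y) U p
  occurs-++ X Y U p oX oY t t< with t <? length X
  ... | yes t<X = trans (oX t t<X) (sym (!?-++ˡ X Y t<X))
  ... | no t≮X  = begin
    U !? (p + t)                ≡⟨ cong (λ n → U !? (p + n)) (sym t≡) ⟩
    U !? (p + (length X + u))   ≡⟨ cong (U !?_) (sym (+-assoc p (length X) u)) ⟩
    U !? (p + length X + u)     ≡⟨ oY u u< ⟩
    Y !? u                      ≡⟨ sym (!?-++ʳ X Y u) ⟩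
    (X ++ Y) !? (length X + u)  ≡⟨ cong ((X ++ Y) !?_) t≡ ⟩
    (X ++ Y) !? t               ∎
    where
    u = t ∸ length X
    t≡ : length X + u ≡ t
    t≡ = m+[n∸m]≡n (≮⇒≥ t≮X)
    u< : u < length Y
    u< = +-cancelˡ-< (length X) u (length Y) (subst₂ _<_ (sym t≡) (length-++ X) t<)

  occurs-take : (X U : List A) (p k : ℕ) → Occurs X U p → Occurs (take k X) U p
  occurs-take X U p k oX t t< =
    trans (oX t (≤-trans t<′ (m⊓n≤n k (length X)))) (sym (!?-take X (≤-trans t<′ (m⊓n≤m k (length X)))))
    where t<′ = subst (t <_) (length-take k X) t<

  occurs-drop : (X U : List A) (p k : ℕ) → Occurs X U p → Occurs (drop k X) U (p + k)
  occurs-drop X U p k oX t t< = begin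
    U !? (p + k + t)    ≡⟨ cong (U !?_) (+-assoc p k t) ⟩
    U !? (p + (k + t))  ≡⟨ oX (k + t) k+t< ⟩
    X !? (k + t)        ≡⟨ sym (!?-drop X k t) ⟩
    drop k X !? t       ∎
    where
    k+t< : k + t < length X
    k+t< = +-lemma (subst (t <_) (length-drop k X) t<)
      where
      +-lemma : ∀ {k t n} → t < n ∸ k → k + t < n
      +-lemma {zero}          t< = t<
      +-lemma {suc k} {n = suc n} t< = s≤s (+-lemma {k} t<)

  occurs-at : (X U : List A) {p q : ℕ} → p ≡ q → Occurs X U p → Occurs X U q
  occurs-at X U refl o = o

  Agree : List A → ℕ → ℕ → ℕ → Set
  Agree U p q n = ∀ t → t < n → U !? (p + t) ≡ U !? (q + t)

  SquareAt : List A → ℕ → ℕ → Set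
  SquareAt U s ℓ = Agree U s (s + ℓ) ℓ

  occurs-transfer : (X U : List A) {p q n : ℕ} → Agree U p q n →
                    (k : ℕ) → k + length X ≤ n → Occurs X U (p + k) → Occurs X U (q + k)
  occurs-transfer X U {p} {q} agree k bound oX t t< = begin
    U !? (q + k + t)    ≡⟨ cong (U !?_) (+-assoc q k t) ⟩
    U !? (q + (k + t))  ≡⟨ sym (agree (k + t) (<-≤-trans (+-monoʳ-< k t<) bound)) ⟩
    U !? (p + (k + t))  ≡⟨ cong (U !?_) (sym (+-assoc p k t)) ⟩
    U !? (p + k + t)    ≡⟨ oX t t< ⟩
    X !? t              ∎

  occurs-shift : (X U : List A) {s ℓ r : ℕ} → SquareAt U s ℓ →
                 s ≤ r → r + length X ≤ s + ℓ → Occurs X U r → Occurs X U (r + ℓ)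
  occurs-shift X U {s} {ℓ} {r} square s≤r bound oX =
    occurs-at X U shifted
      (occurs-transfer X U square (r ∸ s) inside (occurs-at X U (sym (m+[n∸m]≡n s≤r)) oX))
    where
    inside : r ∸ s + length X ≤ ℓ
    inside = +-cancelˡ-≤ s _ ℓ (subst (_≤ s + ℓ)
               (trans (cong (_+ length X) (sym (m+[n∸m]≡n s≤r))) (+-assoc s (r ∸ s) (length X))) bound)
    shifted : s + ℓ + (r ∸ s) ≡ r + ℓ
    shifted = trans (+-assoc s ℓ (r ∸ s)) (trans (cong (s +_) (+-comm ℓ (r ∸ s)))
                (trans (sym (+-assoc s (r ∸ s) ℓ)) (cong (_+ ℓ) (m+[n∸m]≡n s≤r))))


  length-take-≤ : (n : ℕ) (xs : List A) → n ≤ length xs → length (take n xs) ≡ n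
  length-take-≤ n xs n≤ = trans (length-take n xs) (m≤n⇒m⊓n≡m n≤)

  length-lastN : (n : ℕ) (xs : List A) → n ≤ length xs → length (lastN n xs) ≡ n
  length-lastN n xs n≤ = trans (length-drop (length xs ∸ n) xs) (m∸[m∸n]≡n n≤)

  occurs-lastN : (X U : List A) {p n : ℕ} → n ≤ length X → Occurs X U p → Occurs (lastN n X) U (p + length X ∸ n)
  occurs-lastN X U {p} {n} n≤ oX = occurs-at (lastN n X) U (sym (+-∸-assoc p n≤)) (occurs-drop X U p (length X ∸ n) oX)

  agree-sym : {U : List A} {p q n : ℕ} → Agree U p q n → Agree U q p n
  agree-sym agree t t< = sym (agree t t<)

  square-within : (T U : List A) {p i ℓ : ℕ} → Occurs T U p → i + ℓ + ℓ ≤ length T → SquareAt U (p + i) ℓ → SquareAt T i ℓ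
  square-within T U {p} {i} {ℓ} oT fits square t t< = begin
    T !? (i + t)          ≡⟨ sym (oT (i + t) (≤-<-trans (+-monoˡ-≤ t (m≤m+n i ℓ)) second<)) ⟩
    U !? (p + (i + t))    ≡⟨ cong (U !?_) (sym (+-assoc p i t)) ⟩
    U !? (p + i + t)      ≡⟨ square t t< ⟩
    U !? (p + i + ℓ + t)  ≡⟨ cong (U !?_) (trans (cong (_+ t) (+-assoc p i ℓ)) (+-assoc p (i + ℓ) t)) ⟩
    U !? (p + (i + ℓ + t)) ≡⟨ oT (i + ℓ + t) second< ⟩
    T !? (i + ℓ + t)      ∎
    where
    open ≡-Reasoning
    second< : i + ℓ + t < length T
    second< = <-≤-trans (+-monoʳ-< (i + ℓ) t<) fits

  square-into : (T U : List A) {p i ℓ : ℕ} → Occurs T U p → i + ℓ + ℓ ≤ length T → SquareAt T i ℓ → SquareAt U (p + i) ℓ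
  square-into T U {p} {i} {ℓ} oT fits square t t< = begin
    U !? (p + i + t)        ≡⟨ cong (U !?_) (+-assoc p i t) ⟩
    U !? (p + (i + t))      ≡⟨ oT (i + t) (≤-<-trans (+-monoˡ-≤ t (m≤m+n i ℓ)) second<) ⟩
    T !? (i + t)            ≡⟨ square t t< ⟩
    T !? (i + ℓ + t)        ≡⟨ sym (oT (i + ℓ + t) second<) ⟩
    U !? (p + (i + ℓ + t))  ≡⟨ cong (U !?_) (sym (trans (cong (_+ t) (+-assoc p i ℓ)) (+-assoc p (i + ℓ) t))) ⟩
    U !? (p + i + ℓ + t)    ∎
    where
    open ≡-Reasoning
    second< : i + ℓ + t < length T
    second< = <-≤-trans (+-monoʳ-< (i + ℓ) t<) fits

  square-in-middle : (x y z : List A) → SquareAt (x ++ y ++ y ++ z) (length x) (length y)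
  square-in-middle x y z t t< = begin
    (x ++ y ++ y ++ z) !? (length x + t)               ≡⟨ !?-++ʳ x (y ++ y ++ z) t ⟩
    (y ++ y ++ z) !? t                                 ≡⟨ !?-++ˡ y (y ++ z) t< ⟩
    y !? t                                             ≡⟨ sym (!?-++ˡ y z t<) ⟩
    (y ++ z) !? t                                      ≡⟨ sym (!?-++ʳ y (y ++ z) t) ⟩
    (y ++ y ++ z) !? (length y + t)                    ≡⟨ sym (!?-++ʳ x (y ++ y ++ z) (length y + t)) ⟩
    (x ++ y ++ y ++ z) !? (length x + (length y + t))  ≡⟨ cong ((x ++ y ++ y ++ z) !?_) (sym (+-assoc (length x) (length y) t)) ⟩
    (x ++ y ++ y ++ z) !? (length x + length y + t)    ∎
    where open ≡-Reasoning

  occurs-conjugate : (u v : List A) → Occurs (v ++ u) ((u ++ v) ++ (u ++ v) ++ (u ++ v)) (length u)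
  occurs-conjugate u v t t< = begin
    ((u ++ v) ++ (u ++ v) ++ (u ++ v)) !? (length u + t)    ≡⟨ cong (_!? (length u + t)) rearranged ⟩
    (u ++ (v ++ u) ++ (v ++ u ++ v)) !? (length u + t)      ≡⟨ !?-++ʳ u ((v ++ u) ++ (v ++ u ++ v)) t ⟩
    ((v ++ u) ++ (v ++ u ++ v)) !? t                        ≡⟨ !?-++ˡ (v ++ u) (v ++ u ++ v) t< ⟩
    (v ++ u) !? t                                           ∎
    where
    open ≡-Reasoning
    rearranged : (u ++ v) ++ (u ++ v) ++ (u ++ v) ≡ u ++ (v ++ u) ++ (v ++ u ++ v)
    rearranged = trans (++-assoc u v _) (cong (u ++_) (trans (sym (++-assoc v (u ++ v) (u ++ v)))
                   (trans (cong (_++ (u ++ v)) (sym (++-assoc v u v))) (++-assoc (v ++ u) v (u ++ v)))))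


module Factorisation {A B : Set} (word : B → List A) where

  open Positions
  open import Data.Nat using (ℕ; zero; suc; _+_; _∸_; _≤_; _<_; z≤n; s≤s)
  open import Data.Nat.Properties
  open import Data.List using (List; []; _∷_; _++_; map; length; concat; concatMap)
  open import Data.List.Properties using (length-++; concat-++; map-++)
  open import Data.Maybe using (just)
  open import Data.Product using (Σ; _×_; _,_)
  open import Data.Sum using (inj₁; inj₂)
  open import Data.Empty using (⊥; ⊥-elim)
  open import Relation.Nullary using (yes; no)
  open import Relation.Binary.PropositionalEquality


  start : List B → ℕ → ℕ
  start []       j       = 0
  start (β ∷ bs) zero    = 0
  start (β ∷ bs) (suc j) = length (word β) + start bs j

  Cut : List B → ℕ → Set
  Cut bs p = Σ ℕ λ j → j ≤ length bs × start bs j ≡ p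

  start-zero : (bs : List B) → start bs 0 ≡ 0
  start-zero []       = refl
  start-zero (β ∷ bs) = refl

  start-suc : (bs : List B) (j : ℕ) {β : B} → bs !? j ≡ just β → start bs (suc j) ≡ start bs j + length (word β)
  start-suc (β ∷ bs) zero    refl = trans (cong (length (word β) +_) (start-zero bs)) (+-identityʳ _)
  start-suc (β ∷ bs) (suc j) e    = trans (cong (length (word β) +_) (start-suc bs j e)) (sym (+-assoc (length (word β)) _ _))

  start-beyond : (bs : List B) (j : ℕ) → length bs ≤ j → start bs j ≡ length (concatMap word bs)
  start-beyond []       j       _       = refl
  start-beyond (β ∷ bs) (suc j) (s≤s p) = trans (cong (length (word β) +_) (start-beyond bs j p)) (sym (length-++ (word β)))

  start-mono : (bs : List B) {j j′ : ℕ} → j ≤ j′ → start bs j ≤ start bs j′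
  start-mono []       _             = z≤n
  start-mono (β ∷ bs) {zero}        _       = z≤n
  start-mono (β ∷ bs) {suc j} {suc j′} (s≤s p) = +-monoʳ-≤ (length (word β)) (start-mono bs p)

  start-<⇒< : (bs : List B) {j j′ : ℕ} → start bs j < start bs j′ → j < j′
  start-<⇒< bs {j} {j′} lt with j <? j′
  ... | yes j<j′ = j<j′
  ... | no  j≮j′ = ⊥-elim (<⇒≱ lt (start-mono bs (≮⇒≥ j≮j′)))

  no-cut-between : (bs : List B) {p : ℕ} (k : ℕ) → Cut bs p → start bs k < p → p < start bs (suc k) → ⊥
  no-cut-between bs k (j , _ , refl) lt gt = <⇒≱ (start-<⇒< bs gt) (start-<⇒< bs lt)

  occurs-block : (bs : List B) (j : ℕ) {β : B} → bs !? j ≡ just β → Occurs (word β) (concatMap word bs) (start bs j)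
  occurs-block (β ∷ bs) zero    refl t t< = !?-++ˡ (word β) (concatMap word bs) t<
  occurs-block (β ∷ bs) (suc j) e    t t< =
    trans (cong (concatMap word (β ∷ bs) !?_) (+-assoc (length (word β)) (start bs j) t))
          (trans (!?-++ʳ (word β) (concatMap word bs) (start bs j + t)) (occurs-block bs j e t t<))

  block-containing : (bs : List B) (p : ℕ) → p < length (concatMap word bs) →
                     Σ ℕ λ j → Σ B λ β → bs !? j ≡ just β × start bs j ≤ p × p < start bs j + length (word β)
  block-containing (β ∷ bs) p p< with p <? length (word β)
  ... | yes p<β = 0 , β , refl , z≤n , p<β
  ... | no  p≮β with block-containing bs (p ∸ length (word β)) rest<
    where
    rest< : p ∸ length (word β) < length (concatMap word bs)
    rest< = +-cancelˡ-< (length (word β)) _ _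
              (subst₂ _<_ (sym (m+[n∸m]≡n (≮⇒≥ p≮β))) (length-++ (word β)) p<)
  ... | j , β′ , e , lo , hi = suc j , β′ , e ,
        subst (length (word β) + start bs j ≤_) (m+[n∸m]≡n (≮⇒≥ p≮β)) (+-monoʳ-≤ (length (word β)) lo) ,
        subst₂ _<_ (m+[n∸m]≡n (≮⇒≥ p≮β)) (sym (+-assoc (length (word β)) (start bs j) _)) (+-monoʳ-< (length (word β)) hi)

  cut-if-not-inside : (bs : List B) (p : ℕ) → p ≤ length (concatMap word bs) →
                      (∀ j {β} → bs !? j ≡ just β → start bs j < p → p < start bs j + length (word β) → ⊥) → Cut bs p
  cut-if-not-inside bs p p≤ inside with p <? length (concatMap word bs)
  ... | no  p≮ = length bs , ≤-refl , trans (start-beyond bs (length bs) ≤-refl) (≤-antisym (≮⇒≥ p≮) p≤)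
  ... | yes p< with block-containing bs p p<
  ... | j , β , e , lo , hi with m≤n⇒m<n∨m≡n lo
  ... | inj₁ lt = ⊥-elim (inside j e lt hi)
  ... | inj₂ eq = j , <⇒≤ (!?-just⇒< bs j e) , eq

  concatMap-++ : (xs ys : List B) → concatMap word (xs ++ ys) ≡ concatMap word xs ++ concatMap word ys
  concatMap-++ xs ys = trans (cong concat (map-++ word xs ys)) (sym (concat-++ (map word xs) (map word ys)))

  start-++ʳ : (xs ys : List B) (j : ℕ) → start (xs ++ ys) (length xs + j) ≡ length (concatMap word xs) + start ys j
  start-++ʳ []       ys j = refl
  start-++ʳ (β ∷ xs) ys j = trans (cong (length (word β) +_) (start-++ʳ xs ys j))
    (trans (sym (+-assoc (length (word β)) _ _)) (cong (_+ start ys j) (sym (length-++ (word β)))))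

  start-++ˡ : (xs ys : List B) (j : ℕ) → j ≤ length xs → start (xs ++ ys) j ≡ start xs j
  start-++ˡ []       ys zero    _       = start-zero ys
  start-++ˡ (β ∷ xs) ys zero    _       = refl
  start-++ˡ (β ∷ xs) ys (suc j) (s≤s h) = cong (length (word β) +_) (start-++ˡ xs ys j h)

  module _ {m : ℕ} (long : ∀ β → m ≤ length (word β)) where

    start-strict : (bs : List B) {j j′ : ℕ} → j < j′ → j′ ≤ length bs → start bs j + m ≤ start bs j′
    start-strict (β ∷ bs) {zero}  {suc j′} _       _       = ≤-trans (long β) (m≤m+n _ _)
    start-strict (β ∷ bs) {suc j} {suc j′} (s≤s p) (s≤s l) =
      subst (_≤ length (word β) + start bs j′) (sym (+-assoc (length (word β)) (start bs j) m))
            (+-monoʳ-≤ (length (word β)) (start-strict bs p l))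

  block-ending-at : (bs : List B) {p : ℕ} → Cut bs p → 0 < p →
                    Σ ℕ λ i → Σ B λ β → bs !? i ≡ just β × start bs i + length (word β) ≡ p
  block-ending-at bs (zero  , _  , refl) 0<p = ⊥-elim (<-irrefl (sym (start-zero bs)) 0<p)
  block-ending-at bs (suc i , i< , refl) _ with !?-defined bs i<
  ... | β , bs[i] = i , β , bs[i] , sym (start-suc bs i bs[i])

  block-starting-at : (bs : List B) {p : ℕ} → Cut bs p → p < length (concatMap word bs) →
                      Σ ℕ λ i → Σ B λ β → bs !? i ≡ just β × start bs i ≡ p
  block-starting-at bs (i , _ , refl) p< with i <? length bs
  ... | yes i< = let β , bs[i] = !?-defined bs i< in i , β , bs[i] , refl
  ... | no  i≮ = ⊥-elim (<-irrefl (start-beyond bs i (≮⇒≥ i≮)) p<)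


module Circular where

  open Positions
  open import Data.Nat using (ℕ; zero; suc; _+_; _∸_; _≤_; _<_; _≤?_; z≤n; s≤s)
  open import Data.Nat.Properties
  open import Data.List using (List; []; _∷_; _++_; length; take; drop)
  open import Data.List.Properties using (length-++; length-take; length-drop; ++-assoc; take++drop≡id)
  open import Data.Empty using (⊥)
  open import Relation.Nullary using (yes; no; ¬_)
  open import Relation.Binary.PropositionalEquality

  private variable A : Set

  drop-++ : (j : ℕ) (xs ys : List A) → j ≤ length xs → drop j (xs ++ ys) ≡ drop j xs ++ ys
  drop-++ zero    xs       ys _       = refl
  drop-++ (suc j) (x ∷ xs) ys (s≤s h) = drop-++ j xs ys h

  module _ (w : List A) where

    private
      n : ℕ
      n = length w
      www : List A
      www = w ++ w ++ w

    !?-cube-period : ∀ j → j < n + n → www !? (n + j) ≡ www !? j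
    !?-cube-period j j< = trans (!?-++ʳ w (w ++ w) j)
      (sym (trans (cong (_!? j) (sym (++-assoc w w w))) (!?-++ˡ (w ++ w) w (subst (j <_) (sym (length-++ w)) j<))))

    square-in-conjugate : CircSquareFree w → ∀ {j r} → j ≤ n → 1 ≤ r → r + r ≤ n → ¬ SquareAt www j r
    square-in-conjugate csf {j} {r} j≤n r≥1 r+r≤n square =
      csf (take j w) (drop j w) (sym (take++drop≡id j w)) [] Y Z Y≢[] conjugate≡
      where
      C : List A
      C = drop j w ++ take j w
      length-C : length C ≡ n
      length-C = trans (length-++ (drop j w)) (trans (+-comm (length (drop j w)) _)
                   (trans (cong₂ _+_ (length-take-≤ j w j≤n) (length-drop j w)) (m+[n∸m]≡n j≤n)))
      drop-www : drop j www ≡ C ++ (drop j w ++ w)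
      drop-www = trans (drop-++ j w (w ++ w) j≤n)
                   (trans (cong (λ v → drop j w ++ v ++ w) (sym (take++drop≡id j w)))
                     (trans (cong (drop j w ++_) (++-assoc (take j w) (drop j w) w))
                       (sym (++-assoc (drop j w) (take j w) (drop j w ++ w)))))
      !?-C : ∀ t → t < n → www !? (j + t) ≡ C !? t
      !?-C t t< = trans (sym (!?-drop www j t)) (trans (cong (_!? t) drop-www) (!?-++ˡ C _ (subst (t <_) (sym length-C) t<)))
      r+t< : ∀ t → t < r → r + t < n
      r+t< t t< = <-≤-trans (+-monoʳ-< r t<) r+r≤n
      square-C : ∀ t → t < r → C !? t ≡ C !? (r + t)
      square-C t t< = trans (sym (!?-C t (≤-trans (s≤s (m≤n+m t r)) (r+t< t t<))))
                        (trans (square t t<) (trans (cong (www !?_) (+-assoc j r t)) (!?-C (r + t) (r+t< t t<))))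
      r≤C : r ≤ length C
      r≤C = subst (r ≤_) (sym length-C) (≤-trans (m≤m+n r r) r+r≤n)
      Y : List A
      Y = take r C
      Z : List A
      Z = drop r (drop r C)
      length-Y : length Y ≡ r
      length-Y = length-take-≤ r C r≤C
      Y≢[] : ¬ Y ≡ []
      Y≢[] Y≡[] = <-irrefl refl (≤-trans r≥1 (≤-reflexive (trans (sym length-Y) (cong length Y≡[]))))
      r≤rest : r ≤ length (drop r C)
      r≤rest = subst (r ≤_) (sym (trans (length-drop r C) (cong (_∸ r) length-C)))
                 (subst (_≤ n ∸ r) (m+n∸n≡m r r) (∸-monoˡ-≤ r r+r≤n))
      second-Y : take r (drop r C) ≡ Y
      second-Y = !?-extensionality _ _ (trans (length-take-≤ r (drop r C) r≤rest) (sym length-Y))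
        (λ t t< → let t<r = subst (t <_) (length-take-≤ r (drop r C) r≤rest) t< in
          trans (!?-take (drop r C) t<r) (trans (!?-drop C r t) (trans (sym (square-C t t<r)) (sym (!?-take C t<r)))))
      conjugate≡ : drop j w ++ take j w ≡ [] ++ Y ++ Y ++ Z
      conjugate≡ = trans (sym (take++drop≡id r C))
                     (cong (Y ++_) (trans (sym (take++drop≡id r (drop r C))) (cong (_++ Z) second-Y)))

    shift-back : ∀ {j r} → n ≤ j → j + r + r ≤ n + (n + n) → SquareAt www j r → SquareAt www (j ∸ n) r
    shift-back {j} {r} n≤j fits square t t< =
      trans (sym (trans (cong (www !?_) e₁) (!?-cube-period (j ∸ n + t) b₁)))
        (trans (square t t<) (trans (cong (www !?_) e₂) (!?-cube-period (j ∸ n + r + t) b₂)))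
      where
      j≡ : n + (j ∸ n) ≡ j
      j≡ = m+[n∸m]≡n n≤j
      e₁ : j + t ≡ n + (j ∸ n + t)
      e₁ = trans (cong (_+ t) (sym j≡)) (+-assoc n (j ∸ n) t)
      e₂ : j + r + t ≡ n + (j ∸ n + r + t)
      e₂ = trans (cong (λ x → x + r + t) (sym j≡))
             (trans (+-assoc (n + (j ∸ n)) r t) (trans (+-assoc n (j ∸ n) (r + t)) (cong (n +_) (sym (+-assoc (j ∸ n) r t)))))
      b₂ : j ∸ n + r + t < n + n
      b₂ = +-cancelˡ-< n _ _ (subst (_< n + (n + n)) e₂ (<-≤-trans (+-monoʳ-< (j + r) t<) fits))
      b₁ : j ∸ n + t < n + n
      b₁ = ≤-<-trans (+-monoˡ-≤ t (m≤m+n (j ∸ n) r)) b₂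

    no-short-square-in-cube : CircSquareFree w → ∀ {j r} → 1 ≤ r → r + r ≤ n → j + r + r ≤ n + (n + n) → ¬ SquareAt www j r
    no-short-square-in-cube csf {j} {r} r≥1 r+r≤n fits square with j ≤? n | j ∸ n ≤? n
    ... | yes j≤n | _ = square-in-conjugate csf j≤n r≥1 r+r≤n square
    ... | no  j≰n | yes j′≤n = square-in-conjugate csf j′≤n r≥1 r+r≤n (shift-back (<⇒≤ (≰⇒> j≰n)) fits square)
    ... | no  j≰n | no  j′≰n = square-in-conjugate csf j″≤n r≥1 r+r≤n
                                 (shift-back (<⇒≤ (≰⇒> j′≰n)) fits′ (shift-back (<⇒≤ (≰⇒> j≰n)) fits square))
      where
      fits′ : j ∸ n + r + r ≤ n + (n + n)
      fits′ = ≤-trans (+-monoˡ-≤ r (+-monoˡ-≤ r (m∸n≤m j n))) fits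
      j″≤n : j ∸ n ∸ n ≤ n
      j″≤n = subst (j ∸ n ∸ n ≤_) (trans (cong (_∸ n) (m+n∸m≡n n (n + n))) (m+n∸m≡n n n))
               (∸-monoˡ-≤ n (∸-monoˡ-≤ n (≤-trans (m≤m+n j (r + r)) (≤-trans (≤-reflexive (sym (+-assoc j r r))) fits))))


module Blocks where

  open import Data.Nat using (ℕ; zero; suc; _+_; _≤_)
  import Data.Nat as ℕ
  open import Data.List using (List; []; _∷_; _++_; map; length; cartesianProduct)
  open import Data.List.Properties using (≡-dec)
  open import Data.List.Membership.Propositional using (_∈_)
  open import Data.List.Membership.Propositional.Properties using (∈-cartesianProduct⁺; ∈-map⁺; ∈-++⁺ˡ; ∈-++⁺ʳ)
  open import Data.List.Relation.Unary.Any using (here; there)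
  open import Data.Product using (_×_; _,_; proj₁)
  open import Relation.Binary.Definitions using (DecidableEquality)
  open import Relation.Nullary using (yes; no)
  open import Relation.Nullary.Decidable using (map′)
  open import Relation.Binary.PropositionalEquality

  data Seed : Set where
    seedQ seedR seedQ′ seedR′ : Seed

  seedWord : Seed → Word
  seedWord seedQ  = Q
  seedWord seedR  = R
  seedWord seedQ′ = Q'
  seedWord seedR′ = R'

  Block : Set
  Block = V × Seed

  vertex : Block → V
  vertex = proj₁

  word : Block → Word
  word (x , k) = image x (seedWord k)

  infix 4 _≟Γ_ _≟V_ _≟ʷ_

  _≟Γ_ : DecidableEquality Γ
  a ≟Γ a = yes refl
  a ≟Γ b = no λ ()
  a ≟Γ c = no λ ()
  b ≟Γ a = no λ ()
  b ≟Γ b = yes refl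
  b ≟Γ c = no λ ()
  c ≟Γ a = no λ ()
  c ≟Γ b = no λ ()
  c ≟Γ c = yes refl

  _≟ʷ_ : DecidableEquality Word
  _≟ʷ_ = ≡-dec _≟Γ_

  vertexIndex : V → ℕ
  vertexIndex (pl id)  = 0
  vertexIndex (pl ab)  = 1
  vertexIndex (pl ac)  = 2
  vertexIndex (pl bc)  = 3
  vertexIndex (pl abc) = 4
  vertexIndex (pl acb) = 5
  vertexIndex (tl id)  = 6
  vertexIndex (tl ab)  = 7
  vertexIndex (tl ac)  = 8
  vertexIndex (tl bc)  = 9
  vertexIndex (tl abc) = 10
  vertexIndex (tl acb) = 11

  indexVertex : ℕ → V
  indexVertex 0  = pl id
  indexVertex 1  = pl ab
  indexVertex 2  = pl ac
  indexVertex 3  = pl bc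
  indexVertex 4  = pl abc
  indexVertex 5  = pl acb
  indexVertex 6  = tl id
  indexVertex 7  = tl ab
  indexVertex 8  = tl ac
  indexVertex 9  = tl bc
  indexVertex 10 = tl abc
  indexVertex _  = tl acb

  indexVertex-vertexIndex : ∀ x → indexVertex (vertexIndex x) ≡ x
  indexVertex-vertexIndex (pl id)  = refl
  indexVertex-vertexIndex (pl ab)  = refl
  indexVertex-vertexIndex (pl ac)  = refl
  indexVertex-vertexIndex (pl bc)  = refl
  indexVertex-vertexIndex (pl abc) = refl
  indexVertex-vertexIndex (pl acb) = refl
  indexVertex-vertexIndex (tl id)  = refl
  indexVertex-vertexIndex (tl ab)  = refl
  indexVertex-vertexIndex (tl ac)  = refl
  indexVertex-vertexIndex (tl bc)  = refl
  indexVertex-vertexIndex (tl abc) = refl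
  indexVertex-vertexIndex (tl acb) = refl

  vertexIndex-injective : ∀ {x y} → vertexIndex x ≡ vertexIndex y → x ≡ y
  vertexIndex-injective {x} {y} e =
    trans (sym (indexVertex-vertexIndex x)) (trans (cong indexVertex e) (indexVertex-vertexIndex y))

  _≟V_ : DecidableEquality V
  x ≟V y = map′ vertexIndex-injective (cong vertexIndex) (vertexIndex x ℕ.≟ vertexIndex y)

  perms : List Perm
  perms = id ∷ ab ∷ ac ∷ bc ∷ abc ∷ acb ∷ []

  ∈-perms : ∀ π → π ∈ perms
  ∈-perms id  = here refl
  ∈-perms ab  = there (here refl)
  ∈-perms ac  = there (there (here refl))
  ∈-perms bc  = there (there (there (here refl)))
  ∈-perms abc = there (there (there (there (here refl))))
  ∈-perms acb = there (there (there (there (there (here refl)))))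

  vertices : List V
  vertices = map pl perms ++ map tl perms

  ∈-vertices : ∀ x → x ∈ vertices
  ∈-vertices (pl π) = ∈-++⁺ˡ (∈-map⁺ pl (∈-perms π))
  ∈-vertices (tl π) = ∈-++⁺ʳ (map pl perms) (∈-map⁺ tl (∈-perms π))

  seeds : List Seed
  seeds = seedQ ∷ seedR ∷ seedQ′ ∷ seedR′ ∷ []

  ∈-seeds : ∀ k → k ∈ seeds
  ∈-seeds seedQ  = here refl
  ∈-seeds seedR  = there (here refl)
  ∈-seeds seedQ′ = there (there (here refl))
  ∈-seeds seedR′ = there (there (there (here refl)))

  blocks : List Block
  blocks = cartesianProduct vertices seeds

  ∈-blocks : ∀ β → β ∈ blocks
  ∈-blocks (x , k) = ∈-cartesianProduct⁺ (∈-vertices x) (∈-seeds k)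

  successors : Block → List Block
  successors β = cartesianProduct (succs (vertex β)) seeds

  ∈-successors : ∀ β {x} k → Arc (vertex β) x → (x , k) ∈ successors β
  ∈-successors β k arc = ∈-cartesianProduct⁺ arc (∈-seeds k)


module BlockChecks where

  open Positions
  open Blocks
  open import Data.Bool using (Bool; true; false; _∧_; _∨_; not; T; if_then_else_)
  open import Data.Bool.ListAction using (all; any)
  open import Data.Bool.Properties using (T-≡; T-∧; T-∨)
  open import Data.Unit using (tt)
  open import Data.Nat using (ℕ; zero; suc; _+_; _∸_; _≤_; _<_; _≤?_; z≤n; s≤s)
  open import Data.Nat.Properties
  open import Data.List using (List; []; _∷_; _++_; map; length; take; drop; reverse; upTo; applyUpTo)
  open import Data.List.Properties using (length-take; length-drop; length-reverse; length-++; reverse-++; take++drop≡id; drop-drop)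
  open import Data.List.Membership.Propositional using (_∈_; lose)
  open import Data.List.Membership.Propositional.Properties using (∈-upTo⁺; ∈-map⁺; ∈-applyUpTo⁺)
  open import Data.List.Relation.Unary.All as All using (All; all?)
  open import Data.List.Relation.Unary.All.Properties using (all⁺)
  open import Data.List.Relation.Unary.Any.Properties using (any⁺)
  open import Data.Product using (_×_; _,_; proj₁; proj₂)
  open import Data.Sum using (_⊎_; inj₁; inj₂)
  import Data.Sum as Sum
  open import Data.Empty using (⊥; ⊥-elim)
  open import Function.Bundles using (Equivalence)
  open import Relation.Nullary using (Dec; yes; no; ¬_)
  open import Data.List.Membership.DecPropositional _≟ʷ_ using (_∈?_)
  open import Relation.Nullary.Decidable using (⌊_⌋; toWitness; fromWitness)
  open import Relation.Binary.PropositionalEquality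

  private variable A : Set

  T-all : (p : A → Bool) (xs : List A) → T (all p xs) → ∀ {x} → x ∈ xs → T (p x)
  T-all p xs h = All.lookup (all⁺ p xs h)

  T-⇒ : ∀ b {c} → T (not b ∨ c) → T b → T c
  T-⇒ true h _ = h

  T-not : ∀ b → T (not b) → ¬ T b
  T-not true () _

  agree : ℕ → Word → Word → Bool
  agree zero    xs       ys       = true
  agree (suc n) []       ys       = false
  agree (suc n) (x ∷ xs) []       = false
  agree (suc n) (x ∷ xs) (y ∷ ys) = ⌊ x ≟Γ y ⌋ ∧ agree n xs ys

  ≟Γ-refl : ∀ x → T ⌊ x ≟Γ x ⌋
  ≟Γ-refl a = tt
  ≟Γ-refl b = tt
  ≟Γ-refl c = tt

  agree-pointwise : (n : ℕ) (xs ys : Word) → n ≤ length xs → n ≤ length ys →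
                    (∀ t → t < n → xs !? t ≡ ys !? t) → T (agree n xs ys)
  agree-pointwise zero    xs       ys       _       _       _  = tt
  agree-pointwise (suc n) (x ∷ xs) (y ∷ ys) (s≤s l) (s≤s l′) eq with eq 0 (s≤s z≤n)
  ... | refl = Equivalence.from T-∧ (≟Γ-refl x , agree-pointwise n xs ys l l′ (λ t t< → eq (suc t) (s≤s t<)))

  agree-++ : (X Y Z : Word) → T (agree (length X) (X ++ Y) (X ++ Z))
  agree-++ X Y Z = agree-pointwise (length X) (X ++ Y) (X ++ Z)
    (subst (length X ≤_) (sym (length-++ X)) (m≤m+n _ _))
    (subst (length X ≤_) (sym (length-++ X)) (m≤m+n _ _))
    (λ t t< → trans (!?-++ˡ X Y t<) (sym (!?-++ˡ X Z t<)))

  ≟V-sound : ∀ {x y} → T ⌊ x ≟V y ⌋ → x ≡ y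
  ≟V-sound = toWitness

  agree-prefix : (k : ℕ) (w w′ : Word) → k ≤ length w → take k w′ ≡ take k w → T (agree k w w′)
  agree-prefix k w w′ k≤ eq = subst₂ (λ n v → T (agree n w v)) (length-take-≤ k w k≤) w′≡
    (subst (λ v → T (agree (length (take k w)) v (take k w ++ drop k w′))) (take++drop≡id k w) (agree-++ (take k w) (drop k w) (drop k w′)))
    where
    w′≡ : take k w ++ drop k w′ ≡ w′
    w′≡ = trans (cong (_++ drop k w′) (sym eq)) (take++drop≡id k w′)

  agree-suffix : (k j : ℕ) (w w′ : Word) → drop j w′ ≡ drop k w → T (agree (length w ∸ k) (reverse w) (reverse w′))
  agree-suffix k j w w′ eq = subst₂ (λ n v → T (agree n v (reverse w′))) (trans (length-reverse (drop k w)) (length-drop k w)) rw≡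
    (subst (λ v → T (agree (length (reverse (drop k w))) (reverse (drop k w) ++ reverse (take k w)) v)) rw′≡
      (agree-++ (reverse (drop k w)) (reverse (take k w)) (reverse (take j w′))))
    where
    rw≡ : reverse (drop k w) ++ reverse (take k w) ≡ reverse w
    rw≡ = trans (sym (reverse-++ (take k w) (drop k w))) (cong reverse (take++drop≡id k w))
    rw′≡ : reverse (drop k w) ++ reverse (take j w′) ≡ reverse w′
    rw′≡ = trans (cong (λ d → reverse d ++ reverse (take j w′)) (sym eq))
             (trans (sym (reverse-++ (take j w′) (drop j w′))) (cong reverse (take++drop≡id j w′)))

  suffixTest : ℕ → Word → V → V × Word → Bool
  suffixTest m rw x (y , rw′) = not (agree m rw rw′) ∨ ⌊ y ≟V x ⌋

  prefixTest : ℕ → Word → V → Block → Bool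
  prefixTest k w x β′ = not (agree k w (word β′)) ∨ ⌊ vertex β′ ≟V x ⌋

  reversedBlocks : List (V × Word)
  reversedBlocks = map (λ β → vertex β , reverse (word β)) blocks

  boundaryTest : List (V × Word) → Block → ℕ → Bool
  boundaryTest reversed β k = all (suffixTest (length (word β) ∸ k) (reverse (word β)) (vertex β)) reversed
                            ∨ all (prefixTest k (word β) (vertex β)) blocks

  cuts : Block → List ℕ
  cuts β = upTo (suc (length (word β)))

  boundary-sound : (βs : List Block) → all (λ β → all (boundaryTest reversedBlocks β) (cuts β)) βs ≡ true →
                   ∀ {β} → β ∈ βs → ∀ k → k ≤ length (word β) →
    (∀ β′ j → drop j (word β′) ≡ drop k (word β) → vertex β′ ≡ vertex β) ⊎
    (∀ β′ → take k (word β′) ≡ take k (word β) → vertex β′ ≡ vertex β)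
  boundary-sound βs check {β} β∈ k k≤ = Sum.map by-suffix by-prefix (Equivalence.to T-∨ at-k)
    where
    m : ℕ
    m = length (word β) ∸ k
    at-k : T (boundaryTest reversedBlocks β k)
    at-k = T-all (boundaryTest reversedBlocks β) (cuts β)
             (T-all (λ β → all (boundaryTest reversedBlocks β) (cuts β)) βs (Equivalence.from T-≡ check) β∈)
             (∈-upTo⁺ (s≤s k≤))
    by-suffix : T (all (suffixTest m (reverse (word β)) (vertex β)) reversedBlocks) →
                ∀ β′ j → drop j (word β′) ≡ drop k (word β) → vertex β′ ≡ vertex β
    by-suffix h β′ j eq = ≟V-sound (T-⇒ (agree m (reverse (word β)) (reverse (word β′)))
      (T-all (suffixTest m (reverse (word β)) (vertex β)) reversedBlocks h
        (∈-map⁺ (λ β → vertex β , reverse (word β)) (∈-blocks β′)))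
      (agree-suffix k j (word β) (word β′) eq))
    by-prefix : T (all (prefixTest k (word β) (vertex β)) blocks) →
                ∀ β′ → take k (word β′) ≡ take k (word β) → vertex β′ ≡ vertex β
    by-prefix h β′ eq = ≟V-sound (T-⇒ (agree k (word β) (word β′))
      (T-all (prefixTest k (word β) (vertex β)) blocks h (∈-blocks β′)) (agree-prefix k (word β) (word β′) k≤ eq))

  noSquarePrefixᵇ : ℕ → ℕ → Word → Word → Bool
  noSquarePrefixᵇ zero    ℓ X Y = true
  noSquarePrefixᵇ (suc f) ℓ X Y = not (agree ℓ X Y) ∧ noSquarePrefixᵇ f (suc ℓ) X (drop 1 Y)

  noShortSquareᵇ : ℕ → Word → Bool
  noShortSquareᵇ zero    X = true
  noShortSquareᵇ (suc n) X = noSquarePrefixᵇ 41 1 X (drop 1 X) ∧ noShortSquareᵇ n (drop 1 X)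

  walkTest : Block → Block → Block → Bool
  walkTest β₁ β₂ β₃ = noShortSquareᵇ (length (word β₁)) (word β₁ ++ word β₂ ++ word β₃)

  drop-suc : (ℓ : ℕ) (X : Word) → drop 1 (drop ℓ X) ≡ drop (suc ℓ) X
  drop-suc ℓ X = trans (drop-drop ℓ 1 X) (cong (λ n → drop n X) (+-comm ℓ 1))

  noSquarePrefix-sound : ∀ f ℓ₀ X → T (noSquarePrefixᵇ f ℓ₀ X (drop ℓ₀ X)) →
                         ∀ ℓ → ℓ₀ ≤ ℓ → ℓ < ℓ₀ + f → ¬ T (agree ℓ X (drop ℓ X))
  noSquarePrefix-sound zero    ℓ₀ X _ ℓ ℓ₀≤ ℓ< = ⊥-elim (<-irrefl refl (≤-<-trans ℓ₀≤ (subst (ℓ <_) (+-identityʳ ℓ₀) ℓ<)))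
  noSquarePrefix-sound (suc f) ℓ₀ X h ℓ ℓ₀≤ ℓ< with Equivalence.to (T-∧ {not (agree ℓ₀ X (drop ℓ₀ X))}) h | m≤n⇒m<n∨m≡n ℓ₀≤
  ... | here , _    | inj₂ refl = T-not (agree ℓ X (drop ℓ X)) here
  ... | _    , rest | inj₁ ℓ₀<  = noSquarePrefix-sound f (suc ℓ₀) X (subst (λ Y → T (noSquarePrefixᵇ f (suc ℓ₀) X Y)) (drop-suc ℓ₀ X) rest)
                                    ℓ ℓ₀< (subst (ℓ <_) (+-suc ℓ₀ f) ℓ<)

  noShortSquare-sound : ∀ n X → T (noShortSquareᵇ n X) →
                        ∀ i ℓ → i < n → 1 ≤ ℓ → ℓ ≤ 41 → ¬ T (agree ℓ (drop i X) (drop ℓ (drop i X)))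
  noShortSquare-sound (suc n) X h i ℓ i< 1≤ ≤41 with Equivalence.to (T-∧ {noSquarePrefixᵇ 41 1 X (drop 1 X)}) h
  noShortSquare-sound (suc n) X h zero    ℓ _        1≤ ≤41 | here , _    = noSquarePrefix-sound 41 1 X here ℓ 1≤ (s≤s ≤41)
  noShortSquare-sound (suc n) X h (suc i) ℓ (s≤s i<) 1≤ ≤41 | _    , rest =
    subst (λ Y → ¬ T (agree ℓ Y (drop ℓ Y))) (drop-drop 1 i X) (noShortSquare-sound n (drop 1 X) rest i ℓ i< 1≤ ≤41)

  square⇒agree : (X : Word) {i ℓ : ℕ} → SquareAt X i ℓ → i + ℓ + ℓ ≤ length X → T (agree ℓ (drop i X) (drop ℓ (drop i X)))
  square⇒agree X {i} {ℓ} square bound = agree-pointwise ℓ (drop i X) (drop ℓ (drop i X)) ℓ≤₁ ℓ≤₂ pointwise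
    where
    room : ℓ + ℓ ≤ length X ∸ i
    room = subst (_≤ length X ∸ i) (m+n∸m≡n i (ℓ + ℓ)) (∸-monoˡ-≤ i (subst (_≤ length X) (+-assoc i ℓ ℓ) bound))
    ℓ≤₁ : ℓ ≤ length (drop i X)
    ℓ≤₁ = subst (ℓ ≤_) (sym (length-drop i X)) (≤-trans (m≤m+n ℓ ℓ) room)
    ℓ≤₂ : ℓ ≤ length (drop ℓ (drop i X))
    ℓ≤₂ = subst (ℓ ≤_) (sym (trans (length-drop ℓ (drop i X)) (cong (_∸ ℓ) (length-drop i X))))
            (subst (_≤ length X ∸ i ∸ ℓ) (m+n∸m≡n ℓ ℓ) (∸-monoˡ-≤ ℓ room))
    pointwise : ∀ t → t < ℓ → drop i X !? t ≡ drop ℓ (drop i X) !? t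
    pointwise t t< = begin
      drop i X !? t                ≡⟨ !?-drop X i t ⟩
      X !? (i + t)                 ≡⟨ square t t< ⟩
      X !? (i + ℓ + t)             ≡⟨ cong (X !?_) (+-assoc i ℓ t) ⟩
      X !? (i + (ℓ + t))           ≡⟨ sym (!?-drop X i (ℓ + t)) ⟩
      drop i X !? (ℓ + t)          ≡⟨ sym (!?-drop (drop i X) ℓ t) ⟩
      drop ℓ (drop i X) !? t       ∎
      where open ≡-Reasoning

  walks-sound : (βs : List Block) → all (λ β₁ → all (λ β₂ → all (walkTest β₁ β₂) (successors β₂)) (successors β₁)) βs ≡ true →
                ∀ {β₁ β₂ β₃} → β₁ ∈ βs → Arc (vertex β₁) (vertex β₂) → Arc (vertex β₂) (vertex β₃) →
                    ∀ {i ℓ} → i < length (word β₁) → 1 ≤ ℓ → ℓ ≤ 41 →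
                    i + ℓ + ℓ ≤ length (word β₁ ++ word β₂ ++ word β₃) → ¬ SquareAt (word β₁ ++ word β₂ ++ word β₃) i ℓ
  walks-sound βs check {β₁} {β₂} {β₃} β₁∈ arc₁₂ arc₂₃ {i} {ℓ} i< 1≤ ≤41 bound square =
    noShortSquare-sound (length (word β₁)) X ok i ℓ i< 1≤ ≤41 (square⇒agree X square bound)
    where
    X : Word
    X = word β₁ ++ word β₂ ++ word β₃
    ok : T (walkTest β₁ β₂ β₃)
    ok = T-all (walkTest β₁ β₂) (successors β₂)
           (T-all (λ β₂ → all (walkTest β₁ β₂) (successors β₂)) (successors β₁)
             (T-all (λ β₁ → all (λ β₂ → all (walkTest β₁ β₂) (successors β₂)) (successors β₁)) βs (Equivalence.from T-≡ check) β₁∈)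
             (∈-successors β₁ (proj₂ β₂) arc₁₂))
           (∈-successors β₂ (proj₂ β₃) arc₂₃)

  _∈ᵇ_ : Word → List Word → Bool
  u ∈ᵇ S = ⌊ u ∈? S ⌋

  ∈ᵇ-intro : ∀ {u S} → u ∈ S → T (u ∈ᵇ S)
  ∈ᵇ-intro = fromWitness

  suffixes : ℕ → List Word
  suffixes d = map (λ β → lastN d (word β)) blocks

  prefixes : ℕ → List Word
  prefixes e = map (λ β → take e (word β)) blocks

  ∈-suffixes : ∀ d β → lastN d (word β) ∈ suffixes d
  ∈-suffixes d β = ∈-map⁺ (λ β → lastN d (word β)) (∈-blocks β)

  ∈-prefixes : ∀ e β → take e (word β) ∈ prefixes e
  ∈-prefixes e β = ∈-map⁺ (λ β → take e (word β)) (∈-blocks β)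

  endsAcrossᵇ : List Word → ℕ → Word → List Word → Bool
  endsAcrossᵇ S k tw L = any (λ u → ⌊ drop k u ≟ʷ tw ⌋ ∧ (take k u ∈ᵇ L)) S

  startsAcrossᵇ : List Word → ℕ → Word → List Word → Bool
  startsAcrossᵇ P k dw L = any (λ u → ⌊ take k u ≟ʷ dw ⌋ ∧ (drop k u ∈ᵇ L)) P

  endsLikeBlockᵇ : ℕ → List Word → Word → ℕ → Bool
  endsLikeBlockᵇ d S w o =
    if ⌊ d ≤? o ⌋ then lastN d (take o w) ∈ᵇ S
    else endsAcrossᵇ S (d ∸ o) (take o w) (suffixes (d ∸ o))

  startsLikeBlockᵇ : ℕ → List Word → Word → ℕ → Bool
  startsLikeBlockᵇ e P w o =
    if ⌊ o + e ≤? length w ⌋ then take e (drop o w) ∈ᵇ P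
    else startsAcrossᵇ P (length w ∸ o) (drop o w) (prefixes (e ∸ (length w ∸ o)))

  offsets : Block → List ℕ
  offsets β = applyUpTo suc (length (word β) ∸ 1)

  offsetTest : ℕ → ℕ → List Word → List Word → Word → ℕ → Bool
  offsetTest d e S P w o = not (endsLikeBlockᵇ d S w o ∧ startsLikeBlockᵇ e P w o)

  synchronisingᵇ : ℕ → ℕ → List Word → List Word → Bool
  synchronisingᵇ d e S P = all (λ β → all (offsetTest d e S P (word β)) (offsets β)) blocks

  opaque
    Synchronising : ℕ → ℕ → Set
    Synchronising d e = synchronisingᵇ d e (suffixes d) (prefixes e) ≡ true

  T-any : (p : A → Bool) {xs : List A} {x : A} → x ∈ xs → T (p x) → T (any p xs)
  T-any p x∈ px = any⁺ p (lose x∈ px)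

  T-≟ʷ : ∀ {u v} → u ≡ v → T ⌊ u ≟ʷ v ⌋
  T-≟ʷ = fromWitness

  T-if-yes : {P : Set} (P? : Dec P) {x y : Bool} → P → T x → T (if ⌊ P? ⌋ then x else y)
  T-if-yes (yes _)  _ h = h
  T-if-yes (no ¬p) p _ = ⊥-elim (¬p p)

  T-if-no : {P : Set} (P? : Dec P) {x y : Bool} → ¬ P → T y → T (if ⌊ P? ⌋ then x else y)
  T-if-no (yes p) ¬p _ = ⊥-elim (¬p p)
  T-if-no (no _)  _  h = h

  ends-like-within : ∀ {d S w o} → d ≤ o → lastN d (take o w) ∈ S → T (endsLikeBlockᵇ d S w o)
  ends-like-within {d} {o = o} d≤o mem = T-if-yes (d ≤? o) d≤o (∈ᵇ-intro mem)

  ends-like-across : ∀ {d S w o u} → ¬ d ≤ o → u ∈ S → drop (d ∸ o) u ≡ take o w →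
                     take (d ∸ o) u ∈ suffixes (d ∸ o) → T (endsLikeBlockᵇ d S w o)
  ends-like-across {d} {S} {w} {o} d≰o u∈ eq mem = T-if-no (d ≤? o) d≰o
    (T-any (λ u → ⌊ drop (d ∸ o) u ≟ʷ take o w ⌋ ∧ (take (d ∸ o) u ∈ᵇ suffixes (d ∸ o))) u∈
      (Equivalence.from T-∧ (T-≟ʷ eq , ∈ᵇ-intro mem)))

  starts-like-within : ∀ {e P w o} → o + e ≤ length w → take e (drop o w) ∈ P → T (startsLikeBlockᵇ e P w o)
  starts-like-within {e} {w = w} {o} fits mem = T-if-yes (o + e ≤? length w) fits (∈ᵇ-intro mem)

  starts-like-across : ∀ {e P w o u} → ¬ o + e ≤ length w → u ∈ P → take (length w ∸ o) u ≡ drop o w →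
                       drop (length w ∸ o) u ∈ prefixes (e ∸ (length w ∸ o)) → T (startsLikeBlockᵇ e P w o)
  starts-like-across {e} {P} {w} {o} overflows u∈ eq mem = T-if-no (o + e ≤? length w) overflows
    (T-any (λ u → ⌊ take (length w ∸ o) u ≟ʷ drop o w ⌋ ∧ (drop (length w ∸ o) u ∈ᵇ prefixes (e ∸ (length w ∸ o)))) u∈
      (Equivalence.from T-∧ (T-≟ʷ eq , ∈ᵇ-intro mem)))

  opaque
    unfolding Synchronising

    synchronising-sound : ∀ {d e} → Synchronising d e → ∀ β {o} → 0 < o → o < length (word β) →
                          T (endsLikeBlockᵇ d (suffixes d) (word β) o) → ¬ T (startsLikeBlockᵇ e (prefixes e) (word β) o)
    synchronising-sound {d} {e} sync β {suc o} _ o< ends starts =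
      T-not (endsLikeBlockᵇ d (suffixes d) (word β) (suc o) ∧ startsLikeBlockᵇ e (prefixes e) (word β) (suc o))
        (T-all (offsetTest d e (suffixes d) (prefixes e) (word β)) (offsets β)
          (T-all (λ β → all (offsetTest d e (suffixes d) (prefixes e) (word β)) (offsets β)) blocks
            (Equivalence.from T-≡ sync) (∈-blocks β))
          (∈-applyUpTo⁺ suc (∸-monoˡ-≤ 1 o<)))
        (Equivalence.from T-∧ (ends , starts))


module BlockFacts where

  open Positions
  open Blocks
  open BlockChecks
  open import Data.Bool using (true; T)
  open import Data.Bool.ListAction using (all)
  open import Data.Bool.Properties using (T-≡)
  open import Data.Unit using (tt)
  open import Data.Nat using (_≤_; _<_; _∸_; _+_; _≤?_)
  open import Data.List using (List; _++_; length; take; drop)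
  open import Data.List.Relation.Unary.All as All using (All; all?)
  open import Data.Product using (_×_)
  open import Data.Sum using (_⊎_)
  open import Function.Bundles using (Equivalence)
  open import Relation.Nullary using (Dec; isYes; ¬_)
  open import Relation.Nullary.Decidable using (toWitness; _×-dec_; _→-dec_)
  open import Relation.Binary.PropositionalEquality

  by-decision : {P : Set} (P? : Dec P) → isYes P? ≡ true → P
  by-decision P? e = toWitness {a? = P?} (subst T (sym e) tt)

  block-lengths : All (λ β → 41 ≤ length (word β) × length (word β) ≤ 65) blocks
  block-lengths = by-decision (all? (λ β → (41 ≤? length (word β)) ×-dec (length (word β) ≤? 65)) blocks) refl

  block-length : ∀ β → 41 ≤ length (word β) × length (word β) ≤ 65
  block-length β = All.lookup block-lengths (∈-blocks β)

  words-determine-vertices : All (λ β → All (λ β′ → word β ≡ word β′ → vertex β ≡ vertex β′) blocks) blocks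
  words-determine-vertices =
    by-decision (all? (λ β → all? (λ β′ → (word β ≟ʷ word β′) →-dec (vertex β ≟V vertex β′)) blocks) blocks) refl

  word-determines-vertex : ∀ β β′ → word β ≡ word β′ → vertex β ≡ vertex β′
  word-determines-vertex β β′ = All.lookup (All.lookup words-determine-vertices (∈-blocks β)) (∈-blocks β′)

  boundaries-determine-vertices : all (λ β → all (boundaryTest reversedBlocks β) (cuts β)) blocks ≡ true
  boundaries-determine-vertices = refl

  boundary-determines-vertex : ∀ β k → k ≤ length (word β) →
    (∀ β′ j → drop j (word β′) ≡ drop k (word β) → vertex β′ ≡ vertex β) ⊎
    (∀ β′ → take k (word β′) ≡ take k (word β) → vertex β′ ≡ vertex β)
  boundary-determines-vertex β = boundary-sound blocks boundaries-determine-vertices (∈-blocks β)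

  short-walks-square-free : all (λ β₁ → all (λ β₂ → all (walkTest β₁ β₂) (successors β₂)) (successors β₁)) blocks ≡ true
  short-walks-square-free = refl

  no-short-square : ∀ {β₁ β₂ β₃} → Arc (vertex β₁) (vertex β₂) → Arc (vertex β₂) (vertex β₃) →
                    ∀ {i ℓ} → i < length (word β₁) → 1 ≤ ℓ → ℓ ≤ 41 →
                    i + ℓ + ℓ ≤ length (word β₁ ++ word β₂ ++ word β₃) → ¬ SquareAt (word β₁ ++ word β₂ ++ word β₃) i ℓ
  no-short-square {β₁} = walks-sound blocks short-walks-square-free (∈-blocks β₁)

  opaque
    unfolding Synchronising

    synchronising-34-0 : Synchronising 34 0
    synchronising-34-0 = refl

    synchronising-0-34 : Synchronising 0 34
    synchronising-0-34 = refl

    synchronising-12-12 : Synchronising 12 12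
    synchronising-12-12 = refl

    synchronising-9-33 : Synchronising 9 33
    synchronising-9-33 = refl

    synchronising-33-9 : Synchronising 33 9
    synchronising-33-9 = refl

    synchronising-10-12 : Synchronising 10 12
    synchronising-10-12 = refl

    synchronising-12-10 : Synchronising 12 10
    synchronising-12-10 = refl


module Synchronisation where

  open Positions
  open Blocks
  open BlockChecks
  open BlockFacts
  open Factorisation word
  open import Data.Bool using (T)
  open import Data.List.Membership.Propositional using (_∈_)
  open import Data.Nat using (ℕ; zero; suc; _+_; _∸_; _≤_; _<_; _≤?_; z≤n; s≤s)
  open import Data.Nat.Properties
  open import Data.List using (List; length; take; drop; concatMap)
  open import Data.List.Properties using (length-drop)
  open import Data.Maybe using (just)
  open import Data.Product using (Σ; _×_; _,_; proj₁; proj₂)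
  open import Data.Empty using (⊥; ⊥-elim)
  open import Relation.Nullary using (yes; no; ¬_)
  open import Relation.Nullary.Decidable using (toSum)
  open import Data.Sum using ([_,_]′)
  open import Relation.Binary.PropositionalEquality

  block-long : ∀ β → 34 ≤ length (word β)
  block-long β = ≤-trans (m≤n+m 34 7) (proj₁ (block-length β))

  module _ (bs : List Block) where

    private
      U : Word
      U = concatMap word bs

    suffix-before-cut : ∀ {d p} → Cut bs p → d ≤ p → d ≤ 34 → Σ Block λ β → Occurs (lastN d (word β)) U (p ∸ d)
    suffix-before-cut {zero}  _   _   _  = (pl id , seedQ) , occurs-[] U _
    suffix-before-cut {suc d} cut d≤p d≤ with block-ending-at bs cut (≤-trans (s≤s z≤n) d≤p)
    ... | i , β , bs[i] , ends = β , occurs-at (lastN (suc d) (word β)) U (cong (_∸ suc d) ends)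
                                       (occurs-lastN (word β) U (≤-trans d≤ (block-long β)) (occurs-block bs i bs[i]))

    prefix-after-cut : ∀ {e p} → Cut bs p → p + e ≤ length U → e ≤ 34 → Σ Block λ β → Occurs (take e (word β)) U p
    prefix-after-cut {zero}  _   _    _  = (pl id , seedQ) , occurs-[] U _
    prefix-after-cut {suc e} {p} cut fits e≤ with block-starting-at bs cut (<-≤-trans (m<m+n p (s≤s z≤n)) fits)
    ... | i , β , bs[i] , starts = β , occurs-at (take (suc e) (word β)) U starts
                                         (occurs-take (word β) U (start bs i) (suc e) (occurs-block bs i bs[i]))

    module _ {j : ℕ} {β : Block} (bs[j] : bs !? j ≡ just β) {o q : ℕ}
             (offset<length : o < length (word β)) (q≡ : start bs j + o ≡ q) where

      private
        occurs-w : Occurs (word β) U (start bs j)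
        occurs-w = occurs-block bs j bs[j]

      ends-like-block : ∀ {d β′} → d ≤ 34 → d ≤ q → Occurs (lastN d (word β′)) U (q ∸ d) →
                        T (endsLikeBlockᵇ d (suffixes d) (word β) o)
      ends-like-block {d} {β′} d≤34 d≤q occurs-L = [ within , across ]′ (toSum (d ≤? o))
        where
        L : Word
        L = lastN d (word β′)
        length-L : length L ≡ d
        length-L = length-lastN d (word β′) (≤-trans d≤34 (block-long β′))
        length-take-o : length (take o (word β)) ≡ o
        length-take-o = length-take-≤ o (word β) (<⇒≤ offset<length)

        within : d ≤ o → T (endsLikeBlockᵇ d (suffixes d) (word β) o)
        within d≤o = ends-like-within {d} {suffixes d} {(word β)} {o} d≤o (subst (_∈ suffixes d) (sym X≡L) (∈-suffixes d β′))
          where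
          d≤ : d ≤ length (take o (word β))
          d≤ = subst (d ≤_) (sym length-take-o) d≤o
          X : Word
          X = lastN d (take o (word β))
          X≡L : X ≡ L
          X≡L = occurs-unique X L U (q ∸ d) (trans (length-lastN d (take o (word β)) d≤) (sym length-L))
                  (occurs-at X U (cong (_∸ d) (trans (cong (start bs j +_) length-take-o) q≡))
                    (occurs-lastN (take o (word β)) U d≤ (occurs-take (word β) U (start bs j) o occurs-w)))
                  occurs-L

        across : ¬ d ≤ o → T (endsLikeBlockᵇ d (suffixes d) (word β) o)
        across d≰o = previous (block-ending-at bs (j , <⇒≤ (!?-just⇒< bs j bs[j]) , refl) (≤-trans k≥1 k≤start))
          where
          k : ℕ
          k = d ∸ o
          d≡ : o + k ≡ d
          d≡ = m+[n∸m]≡n (<⇒≤ (≰⇒> d≰o))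
          k≥1 : 1 ≤ k
          k≥1 = m<n⇒0<n∸m (≰⇒> d≰o)
          k≤start : k ≤ start bs j
          k≤start = +-cancelˡ-≤ o k (start bs j) (subst₂ _≤_ (sym d≡) (trans (sym q≡) (+-comm (start bs j) o)) d≤q)
          window-start : q ∸ d ≡ start bs j ∸ k
          window-start = trans (cong₂ _∸_ (sym q≡) (sym d≡))
                               (trans (cong (_∸ (o + k)) (+-comm (start bs j) o)) ([m+n]∸[m+o]≡n∸o o (start bs j) k))
          tail≡ : drop k L ≡ take o (word β)
          tail≡ = occurs-unique (drop k L) (take o (word β)) U (start bs j)
                    (trans (length-drop k L) (trans (cong (_∸ k) (trans length-L (sym d≡))) (trans (m+n∸n≡m o k) (sym length-take-o))))
                    (occurs-at (drop k L) U (trans (cong (_+ k) window-start) (m∸n+n≡m k≤start)) (occurs-drop L U (q ∸ d) k occurs-L))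
                    (occurs-take (word β) U (start bs j) o occurs-w)
          previous : (Σ ℕ λ i → Σ Block λ β₀ → bs !? i ≡ just β₀ × start bs i + length (word β₀) ≡ start bs j) →
                     T (endsLikeBlockᵇ d (suffixes d) (word β) o)
          previous (i , β₀ , bs[i] , ends) =
            ends-like-across {d} {suffixes d} {(word β)} {o} {L} d≰o (∈-suffixes d β′) tail≡ (subst (_∈ suffixes k) (sym head≡) (∈-suffixes k β₀))
            where
            k≤β₀ : k ≤ length (word β₀)
            k≤β₀ = ≤-trans (m∸n≤m d o) (≤-trans d≤34 (block-long β₀))
            head≡ : take k L ≡ lastN k (word β₀)
            head≡ = occurs-unique (take k L) (lastN k (word β₀)) U (q ∸ d)
                      (trans (length-take-≤ k L (subst (k ≤_) (sym length-L) (m∸n≤m d o))) (sym (length-lastN k (word β₀) k≤β₀)))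
                      (occurs-take L U (q ∸ d) k occurs-L)
                      (occurs-at (lastN k (word β₀)) U (trans (cong (_∸ k) ends) (sym window-start))
                        (occurs-lastN (word β₀) U k≤β₀ (occurs-block bs i bs[i])))

      starts-like-block : ∀ {e β′} → e ≤ 34 → q + e ≤ length U → Occurs (take e (word β′)) U q →
                          T (startsLikeBlockᵇ e (prefixes e) (word β) o)
      starts-like-block {e} {β′} e≤34 fits occurs-P = [ within , across ]′ (toSum (o + e ≤? length (word β)))
        where
        P : Word
        P = take e (word β′)
        length-P : length P ≡ e
        length-P = length-take-≤ e (word β′) (≤-trans e≤34 (block-long β′))
        occurs-rest : Occurs (drop o (word β)) U q
        occurs-rest = occurs-at (drop o (word β)) U q≡ (occurs-drop (word β) U (start bs j) o occurs-w)

        within : o + e ≤ length (word β) → T (startsLikeBlockᵇ e (prefixes e) (word β) o)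
        within inside = starts-like-within {e} {prefixes e} {(word β)} {o} inside (subst (_∈ prefixes e) (sym X≡P) (∈-prefixes e β′))
          where
          e≤rest : e ≤ length (drop o (word β))
          e≤rest = subst (e ≤_) (sym (length-drop o (word β))) (subst (_≤ length (word β) ∸ o) (m+n∸m≡n o e) (∸-monoˡ-≤ o inside))
          X : Word
          X = take e (drop o (word β))
          X≡P : X ≡ P
          X≡P = occurs-unique X P U q (trans (length-take-≤ e (drop o (word β)) e≤rest) (sym length-P))
                  (occurs-take (drop o (word β)) U q e occurs-rest) occurs-P

        across : ¬ o + e ≤ length (word β) → T (startsLikeBlockᵇ e (prefixes e) (word β) o)
        across overflows = next (block-starting-at bs (suc j , !?-just⇒< bs j bs[j] , refl) next<)
          where
          m : ℕ
          m = length (word β) ∸ o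
          m<e : m < e
          m<e = subst (m <_) (m+n∸m≡n o e) (∸-monoˡ-< (≰⇒> overflows) (<⇒≤ offset<length))
          next≡ : start bs (suc j) ≡ q + m
          next≡ = trans (start-suc bs j bs[j]) (trans (cong (start bs j +_) (sym (m+[n∸m]≡n (<⇒≤ offset<length))))
                    (trans (sym (+-assoc (start bs j) o m)) (cong (_+ m) q≡)))
          next< : start bs (suc j) < length U
          next< = subst (_< length U) (sym next≡) (<-≤-trans (+-monoʳ-< q m<e) fits)
          head≡ : take m P ≡ drop o (word β)
          head≡ = occurs-unique (take m P) (drop o (word β)) U q
                    (trans (length-take-≤ m P (subst (m ≤_) (sym length-P) (<⇒≤ m<e))) (sym (length-drop o (word β))))
                    (occurs-take P U q m occurs-P) occurs-rest
          next : (Σ ℕ λ i → Σ Block λ β₂ → bs !? i ≡ just β₂ × start bs i ≡ start bs (suc j)) →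
                 T (startsLikeBlockᵇ e (prefixes e) (word β) o)
          next (i , β₂ , bs[i] , starts) =
            starts-like-across {e} {prefixes e} {(word β)} {o} {P} overflows (∈-prefixes e β′) head≡ (subst (_∈ prefixes (e ∸ m)) (sym tail≡) (∈-prefixes (e ∸ m) β₂))
            where
            e∸m≤β₂ : e ∸ m ≤ length (word β₂)
            e∸m≤β₂ = ≤-trans (m∸n≤m e m) (≤-trans e≤34 (block-long β₂))
            tail≡ : drop m P ≡ take (e ∸ m) (word β₂)
            tail≡ = occurs-unique (drop m P) (take (e ∸ m) (word β₂)) U (q + m)
                      (trans (length-drop m P) (trans (cong (_∸ m) length-P) (sym (length-take-≤ (e ∸ m) (word β₂) e∸m≤β₂))))
                      (occurs-drop P U q m occurs-P)
                      (occurs-at (take (e ∸ m) (word β₂)) U (trans starts next≡)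
                        (occurs-take (word β₂) U (start bs i) (e ∸ m) (occurs-block bs i bs[i])))

    cut-recognised : ∀ {d e} → Synchronising d e → d ≤ 34 → e ≤ 34 →
                     ∀ {p q} → Cut bs p → d ≤ p → d ≤ q → p + e ≤ length U → q + e ≤ length U →
                     Agree U (p ∸ d) (q ∸ d) (d + e) → Cut bs q
    cut-recognised {d} {e} sync d≤34 e≤34 {p} {q} cut d≤p d≤q p-fits q-fits agree =
      cut-if-not-inside bs q (≤-trans (m≤m+n q e) q-fits) inside
      where
      βL : Block
      βL = proj₁ (suffix-before-cut cut d≤p d≤34)
      L : Word
      L = lastN d (word βL)
      βP : Block
      βP = proj₁ (prefix-after-cut cut p-fits e≤34)
      P : Word
      P = take e (word βP)
      occurs-L : Occurs L U (q ∸ d)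
      occurs-L = occurs-at L U (+-identityʳ (q ∸ d))
        (occurs-transfer L U agree 0 (subst (_≤ d + e) (sym (length-lastN d (word βL) (≤-trans d≤34 (block-long βL)))) (m≤m+n d e))
          (occurs-at L U (sym (+-identityʳ (p ∸ d))) (proj₂ (suffix-before-cut cut d≤p d≤34))))
      occurs-P : Occurs P U q
      occurs-P = occurs-at P U (m∸n+n≡m d≤q)
        (occurs-transfer P U agree d (≤-reflexive (cong (d +_) (length-take-≤ e (word βP) (≤-trans e≤34 (block-long βP)))))
          (occurs-at P U (sym (m∸n+n≡m d≤p)) (proj₂ (prefix-after-cut cut p-fits e≤34))))
      inside : ∀ j {β} → bs !? j ≡ just β → start bs j < q → q < start bs j + length (word β) → ⊥
      inside j {β} bs[j] after before =
        synchronising-sound {d} {e} sync β (m<n⇒0<n∸m after) o<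
          (ends-like-block bs[j] o< q≡ {d} {βL} d≤34 d≤q occurs-L)
          (starts-like-block bs[j] o< q≡ {e} {βP} e≤34 q-fits occurs-P)
        where
        q≡ : start bs j + (q ∸ start bs j) ≡ q
        q≡ = m+[n∸m]≡n (<⇒≤ after)
        o< : q ∸ start bs j < length (word β)
        o< = +-cancelˡ-< (start bs j) _ _ (subst (_< start bs j + length (word β)) (sym q≡) before)


module ShortSquares where

  open Positions
  open Blocks
  open BlockFacts
  open Factorisation word
  open import Data.Nat using (ℕ; zero; suc; _+_; _∸_; _≤_; _<_; z≤n; s≤s)
  open import Data.Nat.Properties
  open import Data.List using (List; []; _∷_; _++_; map; length; concatMap)
  open import Data.List.Properties using (length-++)
  open import Data.List.Relation.Unary.Linked using (Linked; []; [-]; _∷_)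
  open import Data.Maybe using (just)
  import Data.Maybe
  open import Data.Product using (Σ; _×_; _,_; proj₁; proj₂)
  open import Data.Empty using (⊥)
  open import Relation.Nullary using (¬_)
  open import Relation.Binary.PropositionalEquality

  linked-!? : ∀ {xs : List V} → Linked Arc xs → ∀ j {x y} → xs !? j ≡ just x → xs !? suc j ≡ just y → Arc x y
  linked-!? (arc ∷ _)    zero    refl refl = arc
  linked-!? (_ ∷ linked) (suc j) e₁   e₂   = linked-!? linked j e₁ e₂

  vertex-at : (bs : List Block) {k : ℕ} {β : Block} → bs !? k ≡ just β → map vertex bs !? k ≡ just (vertex β)
  vertex-at bs {k} e = trans (!?-map vertex bs k) (cong (Data.Maybe.map vertex) e)

  -- A square of period at most 41 lies within three consecutive blocks, which form a walk in D.
  no-short-square-in : (bs : List Block) → Linked Arc (map vertex bs) →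
                       ∀ {s ℓ} → 1 ≤ ℓ → ℓ ≤ 41 → s + ℓ + ℓ ≤ length (concatMap word bs) →
                       (∀ i → start bs i ≤ s → suc (suc i) < length bs) →
                       ¬ SquareAt (concatMap word bs) s ℓ
  no-short-square-in bs walk {s} {ℓ} ℓ≥1 ℓ≤41 fits room square =
    no-short-square (linked-!? walk i (vertex-at bs bs[i]) (vertex-at bs bs[i+1])) (linked-!? walk (suc i) (vertex-at bs bs[i+1]) (vertex-at bs bs[i+2]))
      offset< ℓ≥1 ℓ≤41 T-fits (square-within T U (occurs-T) T-fits (subst (λ p → SquareAt U p ℓ) (sym s≡) square))
    where
    U : Word
    U = concatMap word bs
    containing = block-containing bs s (<-≤-trans (m<m+n s ℓ≥1) (≤-trans (m≤m+n (s + ℓ) ℓ) fits))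
    i : ℕ
    i = proj₁ containing
    β₀ : Block
    β₀ = proj₁ (proj₂ containing)
    bs[i] : bs !? i ≡ just β₀
    bs[i] = proj₁ (proj₂ (proj₂ containing))
    start≤s : start bs i ≤ s
    start≤s = proj₁ (proj₂ (proj₂ (proj₂ containing)))
    i+2< : suc (suc i) < length bs
    i+2< = room i start≤s
    β₁ β₂ : Block
    β₁ = proj₁ (!?-defined bs {suc i} (<-trans (n<1+n _) i+2<))
    β₂ = proj₁ (!?-defined bs i+2<)
    bs[i+1] : bs !? suc i ≡ just β₁
    bs[i+1] = proj₂ (!?-defined bs {suc i} (<-trans (n<1+n _) i+2<))
    bs[i+2] : bs !? suc (suc i) ≡ just β₂
    bs[i+2] = proj₂ (!?-defined bs i+2<)
    T : Word
    T = word β₀ ++ word β₁ ++ word β₂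
    occurs-T : Occurs T U (start bs i)
    occurs-T = occurs-++ (word β₀) (word β₁ ++ word β₂) U (start bs i) (occurs-block bs i bs[i])
      (occurs-++ (word β₁) (word β₂) U (start bs i + length (word β₀))
        (occurs-at (word β₁) U (start-suc bs i bs[i]) (occurs-block bs (suc i) bs[i+1]))
        (occurs-at (word β₂) U (trans (start-suc bs (suc i) bs[i+1]) (cong (_+ length (word β₁)) (start-suc bs i bs[i])))
          (occurs-block bs (suc (suc i)) bs[i+2])))
    offset : ℕ
    offset = s ∸ start bs i
    s≡ : start bs i + offset ≡ s
    s≡ = m+[n∸m]≡n start≤s
    offset< : offset < length (word β₀)
    offset< = +-cancelˡ-< (start bs i) _ _ (subst (_< start bs i + length (word β₀)) (sym s≡) (proj₂ (proj₂ (proj₂ (proj₂ containing)))))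
    T-fits : offset + ℓ + ℓ ≤ length T
    T-fits = subst (offset + ℓ + ℓ ≤_) (sym (trans (length-++ (word β₀)) (cong (length (word β₀) +_) (length-++ (word β₁)))))
               (≤-trans (≤-reflexive (+-assoc offset ℓ ℓ))
                 (<⇒≤ (+-mono-<-≤ offset< (+-mono-≤ (≤-trans ℓ≤41 (proj₁ (block-length β₁))) (≤-trans ℓ≤41 (proj₁ (block-length β₂)))))))


module LongSquares where

  open Positions
  open Blocks
  open BlockChecks
  open BlockFacts
  open Synchronisation
  open Factorisation word
  open import Data.Nat using (ℕ; zero; suc; _+_; _∸_; _≤_; _<_; _≤?_; z≤n; s≤s)
  open import Data.Nat.Properties
  open import Data.List using (List; map; length; take; drop; concatMap)
  open import Data.List.Properties using (length-drop)
  open import Data.Maybe using (just)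
  import Data.Maybe
  open import Data.Product using (Σ; _×_; _,_; proj₁; proj₂)
  open import Data.Sum using (_⊎_; inj₁; inj₂; [_,_]′)
  open import Data.Empty using (⊥; ⊥-elim)
  open import Relation.Nullary using (yes; no; ¬_)
  open import Relation.Nullary.Decidable using (from-yes; toSum)
  open import Relation.Binary.PropositionalEquality

  SynchronisingShape : ℕ → ℕ → Set
  SynchronisingShape d e =
    Σ ℕ λ left → Σ ℕ λ right → Synchronising left right × left ≤ d × right ≤ e × left ≤ 34 × right ≤ 34

  other-at-least : ∀ {d e n} → 42 ≤ d + e → d ≤ n → 42 ∸ n ≤ e
  other-at-least {d} {e} {n} 42≤ d≤n = subst (42 ∸ n ≤_) (m+n∸m≡n n e) (∸-monoˡ-≤ n (≤-trans 42≤ (+-monoˡ-≤ e d≤n)))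

  synchronising-shape : ∀ d e → 42 ≤ d + e → SynchronisingShape d e
  synchronising-shape d e 42≤ with 34 ≤? d | 34 ≤? e | 12 ≤? d | 12 ≤? e | 10 ≤? d | 10 ≤? e
  ... | yes d≥34 | _        | _        | _        | _        | _ =
    (34 , 0 , synchronising-34-0 , d≥34 , z≤n , ≤-refl , z≤n)
  ... | no  _    | yes e≥34 | _        | _        | _        | _ =
    (0 , 34 , synchronising-0-34 , z≤n , e≥34 , z≤n , ≤-refl)
  ... | no  _    | no  _    | yes d≥12 | yes e≥12 | _        | _ =
    (12 , 12 , synchronising-12-12 , d≥12 , e≥12 , from-yes (12 ≤? 34) , from-yes (12 ≤? 34))
  ... | no  _    | no  _    | yes d≥12 | no  _    | _        | yes e≥10 =
    (12 , 10 , synchronising-12-10 , d≥12 , e≥10 , from-yes (12 ≤? 34) , from-yes (10 ≤? 34))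
  ... | no  d≱34 | no  _    | yes _    | no  _    | _        | no  e≱10 =
    (33 , 9 , synchronising-33-9 , other-at-least (subst (42 ≤_) (+-comm d e) 42≤) (≤-pred (≰⇒> e≱10)) , other-at-least 42≤ (≤-pred (≰⇒> d≱34)) , from-yes (33 ≤? 34) , from-yes (9 ≤? 34))
  ... | no  _    | no  _    | no  d≱12 | _        | yes d≥10 | _ =
    (10 , 12 , synchronising-10-12 , d≥10 , ≤-trans (from-yes (12 ≤? 31)) (other-at-least 42≤ (≤-pred (≰⇒> d≱12))) , from-yes (10 ≤? 34) , from-yes (12 ≤? 34))
  ... | no  _    | no  e≱34 | no  _    | _        | no  d≱10 | _ =
    (9 , 33 , synchronising-9-33 , other-at-least (subst (42 ≤_) (+-comm d e) 42≤) (≤-pred (≰⇒> e≱34)) , other-at-least 42≤ (≤-pred (≰⇒> d≱10)) , from-yes (9 ≤? 34) , from-yes (33 ≤? 34))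

  record VertexSquare (bs : List Block) (s ℓ : ℕ) : Set where
    field
      first period    : ℕ
      period≥1        : 1 ≤ period
      repeats         : SquareAt (map vertex bs) first period
      inside          : first + period + period ≤ length bs
      anchor          : ℕ
      anchor≤first    : anchor ≤ first
      s<anchor-end    : s < start bs (suc anchor)
      ends-in-square  : start bs (anchor + period + period) ≤ s + ℓ + ℓ

  module _ (bs : List Block) {s ℓ : ℕ} (long : 42 ≤ ℓ)
           (fits : s + ℓ + ℓ ≤ length (concatMap word bs)) (square : SquareAt (concatMap word bs) s ℓ) where

    private
      U : Word
      U = concatMap word bs

    module _ {d left right : ℕ} (d≤ℓ : d ≤ ℓ) (left≤ : left ≤ d) (right≤ : right ≤ ℓ ∸ d) where

      private
        d+right≤ℓ : d + right ≤ ℓ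
        d+right≤ℓ = ≤-trans (+-monoʳ-≤ d right≤) (≤-reflexive (m+[n∸m]≡n d≤ℓ))

      window : Agree U (s + d ∸ left) (s + ℓ + d ∸ left) (left + right)
      window t t< = begin
        U !? (s + d ∸ left + t)        ≡⟨ cong (λ n → U !? (n + t)) (+-∸-assoc s left≤) ⟩
        U !? (s + (d ∸ left) + t)      ≡⟨ cong (U !?_) (+-assoc s (d ∸ left) t) ⟩
        U !? (s + (d ∸ left + t))      ≡⟨ square (d ∸ left + t) inside ⟩
        U !? (s + ℓ + (d ∸ left + t))  ≡⟨ cong (U !?_) (sym (+-assoc (s + ℓ) (d ∸ left) t)) ⟩
        U !? (s + ℓ + (d ∸ left) + t)  ≡⟨ cong (λ n → U !? (n + t)) (sym (+-∸-assoc (s + ℓ) left≤)) ⟩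
        U !? (s + ℓ + d ∸ left + t)    ∎
        where
        open ≡-Reasoning
        inside : d ∸ left + t < ℓ
        inside = <-≤-trans (+-monoʳ-< (d ∸ left) t<)
                   (≤-trans (≤-reflexive (trans (sym (+-assoc (d ∸ left) left right)) (cong (_+ right) (m∸n+n≡m left≤)))) d+right≤ℓ)

      first-fits : s + d + right ≤ length U
      first-fits = ≤-trans (≤-reflexive (+-assoc s d right)) (≤-trans (+-monoʳ-≤ s d+right≤ℓ) (≤-trans (m≤m+n (s + ℓ) ℓ) fits))

      second-fits : s + ℓ + d + right ≤ length U
      second-fits = ≤-trans (≤-reflexive (+-assoc (s + ℓ) d right)) (≤-trans (+-monoʳ-≤ (s + ℓ) d+right≤ℓ) fits)

      left≤first : left ≤ s + d
      left≤first = ≤-trans left≤ (m≤n+m d s)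

      left≤second : left ≤ s + ℓ + d
      left≤second = ≤-trans left≤ (m≤n+m d (s + ℓ))

    shape-at : ∀ {d} → d ≤ ℓ → SynchronisingShape d (ℓ ∸ d)
    shape-at {d} d≤ℓ = synchronising-shape d (ℓ ∸ d) (subst (42 ≤_) (sym (m+[n∸m]≡n d≤ℓ)) long)

    cut-forward : ∀ {d} → d ≤ ℓ → Cut bs (s + d) → Cut bs (s + ℓ + d)
    cut-forward d≤ℓ cut with shape-at d≤ℓ
    ... | _ , _ , sync , left≤ , right≤ , left≤34 , right≤34 =
      cut-recognised bs sync left≤34 right≤34 cut (left≤first d≤ℓ left≤ right≤) (left≤second d≤ℓ left≤ right≤)
        (first-fits d≤ℓ left≤ right≤) (second-fits d≤ℓ left≤ right≤) (window d≤ℓ left≤ right≤)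

    cut-backward : ∀ {d} → d ≤ ℓ → Cut bs (s + ℓ + d) → Cut bs (s + d)
    cut-backward d≤ℓ cut with shape-at d≤ℓ
    ... | _ , _ , sync , left≤ , right≤ , left≤34 , right≤34 =
      cut-recognised bs sync left≤34 right≤34 cut (left≤second d≤ℓ left≤ right≤) (left≤first d≤ℓ left≤ right≤)
        (second-fits d≤ℓ left≤ right≤) (first-fits d≤ℓ left≤ right≤) (agree-sym {U = U} (window d≤ℓ left≤ right≤))

    cut-shift : ∀ {x} → s ≤ x → x ≤ s + ℓ → Cut bs x → Cut bs (x + ℓ)
    cut-shift {x} s≤x x≤ cut = subst (Cut bs) shifted (cut-forward d≤ℓ (subst (Cut bs) (sym s+d≡x) cut))
      where
      s+d≡x : s + (x ∸ s) ≡ x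
      s+d≡x = m+[n∸m]≡n s≤x
      d≤ℓ : x ∸ s ≤ ℓ
      d≤ℓ = subst (x ∸ s ≤_) (m+n∸m≡n s ℓ) (∸-monoˡ-≤ s x≤)
      shifted : s + ℓ + (x ∸ s) ≡ x + ℓ
      shifted = trans (+-assoc s ℓ (x ∸ s)) (trans (cong (s +_) (+-comm ℓ (x ∸ s)))
                  (trans (sym (+-assoc s (x ∸ s) ℓ)) (cong (_+ ℓ) s+d≡x)))

    cut-unshift : ∀ {x} → s + ℓ ≤ x → x ≤ s + ℓ + ℓ → Cut bs x → Cut bs (x ∸ ℓ)
    cut-unshift {x} sℓ≤x x≤ cut = subst (Cut bs) unshifted (cut-backward d≤ℓ (subst (Cut bs) (sym sℓ+d≡x) cut))
      where
      sℓ+d≡x : s + ℓ + (x ∸ (s + ℓ)) ≡ x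
      sℓ+d≡x = m+[n∸m]≡n sℓ≤x
      d≤ℓ : x ∸ (s + ℓ) ≤ ℓ
      d≤ℓ = subst (x ∸ (s + ℓ) ≤_) (m+n∸m≡n (s + ℓ) ℓ) (∸-monoˡ-≤ (s + ℓ) x≤)
      unshifted : s + (x ∸ (s + ℓ)) ≡ x ∸ ℓ
      unshifted = trans (sym (m+n∸n≡m (s + (x ∸ (s + ℓ))) ℓ))
                    (cong (_∸ ℓ) (trans (+-assoc s (x ∸ (s + ℓ)) ℓ) (trans (cong (s +_) (+-comm (x ∸ (s + ℓ)) ℓ))
                      (trans (sym (+-assoc s ℓ (x ∸ (s + ℓ)))) sℓ+d≡x))))

    private
      len : ℕ
      len = length bs

      ℓ≥1 : 1 ≤ ℓ
      ℓ≥1 = ≤-trans (s≤s z≤n) long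

      cut-at : ∀ k → k ≤ len → Cut bs (start bs k)
      cut-at k k≤ = k , k≤ , refl

      start-< : ∀ {k k′} → k < k′ → k′ ≤ len → start bs k < start bs k′
      start-< {k} k<k′ k′≤ = <-≤-trans (m<m+n (start bs k) (s≤s z≤n)) (start-strict (λ β → proj₁ (block-length β)) bs k<k′ k′≤)

      s+ℓ<|U| : s + ℓ < length U
      s+ℓ<|U| = <-≤-trans (m<m+n (s + ℓ) ℓ≥1) fits

      s<|U| : s < length U
      s<|U| = <-trans (m<m+n s ℓ≥1) s+ℓ<|U|

      containing-s = block-containing bs s s<|U|
      containing-s+ℓ = block-containing bs (s + ℓ) s+ℓ<|U|

      i : ℕ
      i = proj₁ containing-s
      βi : Block
      βi = proj₁ (proj₂ containing-s)
      bs[i] : bs !? i ≡ just βi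
      bs[i] = proj₁ (proj₂ (proj₂ containing-s))
      start-i≤s : start bs i ≤ s
      start-i≤s = proj₁ (proj₂ (proj₂ (proj₂ containing-s)))
      s<end-i : s < start bs (suc i)
      s<end-i = subst (s <_) (sym (start-suc bs i bs[i])) (proj₂ (proj₂ (proj₂ (proj₂ containing-s))))

      m : ℕ
      m = proj₁ containing-s+ℓ
      βm : Block
      βm = proj₁ (proj₂ containing-s+ℓ)
      bs[m] : bs !? m ≡ just βm
      bs[m] = proj₁ (proj₂ (proj₂ containing-s+ℓ))
      start-m≤s+ℓ : start bs m ≤ s + ℓ
      start-m≤s+ℓ = proj₁ (proj₂ (proj₂ (proj₂ containing-s+ℓ)))
      s+ℓ<end-m : s + ℓ < start bs (suc m)
      s+ℓ<end-m = subst (s + ℓ <_) (sym (start-suc bs m bs[m])) (proj₂ (proj₂ (proj₂ (proj₂ containing-s+ℓ))))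

      i<len : i < len
      i<len = !?-just⇒< bs i bs[i]
      m<len : m < len
      m<len = !?-just⇒< bs m bs[m]

      i≤m : i ≤ m
      i≤m = ≤-pred (start-<⇒< bs (≤-<-trans start-i≤s (<-trans (m<m+n s ℓ≥1) s+ℓ<end-m)))

    -- A single block would have to cover the whole square, but blocks are shorter than 2ℓ.
    i≢m : i ≢ m
    i≢m i≡m = <-irrefl refl (≤-<-trans (proj₂ (block-length βi)) 65<βi)
      where
      end : ℕ
      end = start bs (suc i)
      s+ℓ<end-i : s + ℓ < end
      s+ℓ<end-i = subst (λ k → s + ℓ < start bs (suc k)) (sym i≡m) s+ℓ<end-m
      far : s + ℓ + ℓ < end
      far = ≰⇒> λ end≤ → no-cut-between bs i (cut-unshift (<⇒≤ s+ℓ<end-i) end≤ (cut-at (suc i) i<len))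
              (≤-<-trans start-i≤s (subst (_< end ∸ ℓ) (m+n∸n≡m s ℓ) (∸-monoˡ-< s+ℓ<end-i (m≤n+m ℓ s))))
              (∸-monoʳ-< ℓ≥1 (≤-trans (m≤n+m ℓ s) (<⇒≤ s+ℓ<end-i)))
      65<βi : 65 < length (word βi)
      65<βi = +-cancelˡ-< (start bs i) 65 (length (word βi))
                (subst (start bs i + 65 <_) (start-suc bs i bs[i])
                  (≤-<-trans (+-monoˡ-≤ 65 start-i≤s)
                    (≤-<-trans (≤-trans (+-monoʳ-≤ s (≤-trans (from-yes (65 ≤? 84)) (+-mono-≤ long long)))
                                        (≤-reflexive (sym (+-assoc s ℓ ℓ)))) far)))

    i<m : i < m
    i<m = ≤∧≢⇒< i≤m i≢m

    -- If a cut c of the first half reappears as c + ℓ, the next cut after c + ℓ is the shifted-cut of the next cut after c.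
    next-cut-shifted : ∀ k k′ → suc k ≤ len → s < start bs (suc k) → start bs (suc k) ≤ s + ℓ →
                       start bs k′ < start bs (suc k) + ℓ →
                       (suc k′ ≤ len → start bs k + ℓ < start bs (suc k′) × s + ℓ < start bs (suc k′)) →
                       suc k′ ≤ len × start bs (suc k′) ≡ start bs (suc k) + ℓ
    next-cut-shifted k k′ k< s<c c≤ before after = k′< , ≤-antisym ≤shifted-cut (≮⇒≥ contradiction)
      where
      shifted-cut : Cut bs (start bs (suc k) + ℓ)
      shifted-cut = cut-shift (<⇒≤ s<c) c≤ (cut-at (suc k) k<)
      k′<shifted-cut : k′ < proj₁ shifted-cut
      k′<shifted-cut = start-<⇒< bs (subst (start bs k′ <_) (sym (proj₂ (proj₂ shifted-cut))) before)
      k′< : suc k′ ≤ len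
      k′< = ≤-trans k′<shifted-cut (proj₁ (proj₂ shifted-cut))
      ≤shifted-cut : start bs (suc k′) ≤ start bs (suc k) + ℓ
      ≤shifted-cut = subst (start bs (suc k′) ≤_) (proj₂ (proj₂ shifted-cut)) (start-mono bs k′<shifted-cut)
      contradiction : start bs (suc k′) < start bs (suc k) + ℓ → ⊥
      contradiction lt = no-cut-between bs k
          (cut-unshift (<⇒≤ (proj₂ (after k′<))) (≤-trans (<⇒≤ lt) (+-monoˡ-≤ ℓ c≤)) (cut-at (suc k′) k′<))
          (subst (_< start bs (suc k′) ∸ ℓ) (m+n∸n≡m (start bs k) ℓ) (∸-monoˡ-< (proj₁ (after k′<)) (m≤n+m ℓ (start bs k))))
          (subst (start bs (suc k′) ∸ ℓ <_) (m+n∸n≡m (start bs (suc k)) ℓ)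
            (∸-monoˡ-< lt (≤-trans (m≤n+m ℓ s) (<⇒≤ (proj₂ (after k′<))))))

    private
      r : ℕ
      r = m ∸ i
      r+i≡m : r + i ≡ m
      r+i≡m = m∸n+n≡m i≤m
      r≥1 : 1 ≤ r
      r≥1 = m<n⇒0<n∸m i<m

      ≤m : ∀ {t} → t ≤ r → t + i ≤ m
      ≤m {t} t≤ = subst (t + i ≤_) r+i≡m (+-monoˡ-≤ i t≤)

      start≤s+ℓ : ∀ {k} → k ≤ m → start bs k ≤ s + ℓ
      start≤s+ℓ k≤ = ≤-trans (start-mono bs k≤) start-m≤s+ℓ

      s<start : ∀ {k} → suc i ≤ k → s < start bs k
      s<start k≥ = <-≤-trans s<end-i (start-mono bs k≥)

    cuts-shifted : ∀ t → t < r → suc (t + m) ≤ len × start bs (suc (t + m)) ≡ start bs (suc (t + i)) + ℓ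
    cuts-shifted zero    t< = next-cut-shifted i m i<len s<end-i (start≤s+ℓ i<m)
                                (≤-<-trans start-m≤s+ℓ (+-monoˡ-< ℓ s<end-i))
                                (λ _ → ≤-<-trans (+-monoˡ-≤ ℓ start-i≤s) s+ℓ<end-m , s+ℓ<end-m)
    cuts-shifted (suc t) t< =
      next-cut-shifted (suc (t + i)) (suc (t + m)) (≤-trans (≤m t<) (<⇒≤ m<len))
        (s<start (s≤s (≤-trans (m≤n+m i t) (n≤1+n _)))) (start≤s+ℓ (≤m t<))
        (subst (_< start bs (suc (suc (t + i))) + ℓ) (sym (proj₂ previous))
          (+-monoˡ-< ℓ (start-< (n<1+n _) (≤-trans (≤m t<) (<⇒≤ m<len)))))
        (λ k′< → subst (_< start bs (suc (suc (t + m)))) (proj₂ previous) (start-< (n<1+n _) k′<) ,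
                 <-trans (subst (s + ℓ <_) (sym (proj₂ previous)) (+-monoˡ-< ℓ (s<start (s≤s (m≤n+m i t)))))
                         (start-< (n<1+n _) k′<))
      where
      previous : suc (t + m) ≤ len × start bs (suc (t + m)) ≡ start bs (suc (t + i)) + ℓ
      previous = cuts-shifted t (<-trans (n<1+n t) t<)

    private
      block-at : ∀ k → k < len → Σ Block λ β → bs !? k ≡ just β
      block-at k = !?-defined bs

      vertex-at : ∀ {k β} → bs !? k ≡ just β → map vertex bs !? k ≡ just (vertex β)
      vertex-at {k} e = trans (!?-map vertex bs k) (cong (Data.Maybe.map vertex) e)

      shifted-block : ∀ {t} → t ≤ r → 1 ≤ t → t + m ≤ len × start bs (t + m) ≡ start bs (t + i) + ℓ
      shifted-block {suc t} t≤ _ = cuts-shifted t t≤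

      end-of-square : start bs (r + m) ≡ start bs m + ℓ
      end-of-square = trans (proj₂ (shifted-block ≤-refl r≥1)) (cong (λ k → start bs k + ℓ) r+i≡m)

    inner-vertices : ∀ t → suc t < r → map vertex bs !? suc (t + i) ≡ map vertex bs !? suc (t + m)
    inner-vertices t t< = trans (vertex-at bs[k]) (trans (cong just (word-determines-vertex β β′ same-word)) (sym (vertex-at bs[k′])))
      where
      k k′ : ℕ
      k = suc (t + i)
      k′ = suc (t + m)
      k< : suc k ≤ len
      k< = ≤-trans (≤m t<) (<⇒≤ m<len)
      here = cuts-shifted t (<-trans (n<1+n t) t<)
      next = cuts-shifted (suc t) t<
      β β′ : Block
      β = proj₁ (block-at k k<)
      β′ = proj₁ (block-at k′ (proj₁ next))
      bs[k] : bs !? k ≡ just β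
      bs[k] = proj₂ (block-at k k<)
      bs[k′] : bs !? k′ ≡ just β′
      bs[k′] = proj₂ (block-at k′ (proj₁ next))
      same-length : length (word β) ≡ length (word β′)
      same-length = +-cancelˡ-≡ (start bs k + ℓ) _ _ (begin
        start bs k + ℓ + length (word β)    ≡⟨ +-assoc (start bs k) ℓ _ ⟩
        start bs k + (ℓ + length (word β))  ≡⟨ cong (start bs k +_) (+-comm ℓ _) ⟩
        start bs k + (length (word β) + ℓ)  ≡⟨ sym (+-assoc (start bs k) _ ℓ) ⟩
        start bs k + length (word β) + ℓ    ≡⟨ cong (_+ ℓ) (sym (start-suc bs k bs[k])) ⟩
        start bs (suc k) + ℓ                ≡⟨ sym (proj₂ next) ⟩
        start bs (suc k′)                   ≡⟨ start-suc bs k′ bs[k′] ⟩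
        start bs k′ + length (word β′)      ≡⟨ cong (_+ length (word β′)) (proj₂ here) ⟩
        start bs k + ℓ + length (word β′)   ∎)
        where open ≡-Reasoning
      same-word : word β ≡ word β′
      same-word = occurs-unique (word β) (word β′) U (start bs k′) same-length
        (occurs-at (word β) U (sym (proj₂ here))
          (occurs-shift (word β) U square (<⇒≤ (s<start (s≤s (m≤n+m i t))))
            (subst (_≤ s + ℓ) (start-suc bs k bs[k]) (start≤s+ℓ (≤m t<))) (occurs-block bs k bs[k])))
        (occurs-block bs k′ bs[k′])

    private
      kk : ℕ
      kk = s + ℓ ∸ start bs m
      start-m+kk : start bs m + kk ≡ s + ℓ
      start-m+kk = m+[n∸m]≡n start-m≤s+ℓ
      kk<βm : kk < length (word βm)
      kk<βm = +-cancelˡ-< (start bs m) kk _ (subst₂ _<_ (sym start-m+kk) (start-suc bs m bs[m]) s+ℓ<end-m)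
      ds : ℕ
      ds = s ∸ start bs i
      start-i+ds : start bs i + ds ≡ s
      start-i+ds = m+[n∸m]≡n start-i≤s
      ends-ε : start bs (i + r + r) ≤ s + ℓ + ℓ
      ends-ε = subst (_≤ s + ℓ + ℓ) (sym (trans (cong (start bs) (trans (cong (_+ r) (trans (+-comm i r) r+i≡m)) (+-comm m r))) end-of-square))
                 (+-monoˡ-≤ ℓ start-m≤s+ℓ)
      i+r+r≡ : i + r + r ≡ r + m
      i+r+r≡ = trans (cong (_+ r) (trans (+-comm i r) r+i≡m)) (+-comm m r)

    -- The partial blocks at both ends of the square share the tail after s and after s + ℓ.
    tails-agree : drop ds (word βi) ≡ drop kk (word βm)
    tails-agree = occurs-unique (drop ds (word βi)) (drop kk (word βm)) U (s + ℓ) same-length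
      (occurs-shift (drop ds (word βi)) U square ≤-refl (subst (_≤ s + ℓ) (sym end-i) (start≤s+ℓ i<m))
        (occurs-at (drop ds (word βi)) U start-i+ds (occurs-drop (word βi) U (start bs i) ds (occurs-block bs i bs[i]))))
      (occurs-at (drop kk (word βm)) U start-m+kk (occurs-drop (word βm) U (start bs m) kk (occurs-block bs m bs[m])))
      where
      ds≤ : ds ≤ length (word βi)
      ds≤ = +-cancelˡ-≤ (start bs i) ds _ (subst₂ _≤_ (sym start-i+ds) (start-suc bs i bs[i]) (<⇒≤ s<end-i))
      end-i : s + length (drop ds (word βi)) ≡ start bs (suc i)
      end-i = begin
        s + length (drop ds (word βi))              ≡⟨ cong₂ _+_ (sym start-i+ds) (length-drop ds (word βi)) ⟩
        start bs i + ds + (length (word βi) ∸ ds)   ≡⟨ +-assoc (start bs i) ds _ ⟩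
        start bs i + (ds + (length (word βi) ∸ ds)) ≡⟨ cong (start bs i +_) (m+[n∸m]≡n ds≤) ⟩
        start bs i + length (word βi)               ≡⟨ sym (start-suc bs i bs[i]) ⟩
        start bs (suc i)                            ∎
        where open ≡-Reasoning
      end-m : s + ℓ + length (drop kk (word βm)) ≡ start bs (suc i) + ℓ
      end-m = begin
        s + ℓ + length (drop kk (word βm))             ≡⟨ cong₂ _+_ (sym start-m+kk) (length-drop kk (word βm)) ⟩
        start bs m + kk + (length (word βm) ∸ kk)      ≡⟨ +-assoc (start bs m) kk _ ⟩
        start bs m + (kk + (length (word βm) ∸ kk))    ≡⟨ cong (start bs m +_) (m+[n∸m]≡n (<⇒≤ kk<βm)) ⟩
        start bs m + length (word βm)                  ≡⟨ sym (start-suc bs m bs[m]) ⟩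
        start bs (suc m)                               ≡⟨ proj₂ (cuts-shifted 0 r≥1) ⟩
        start bs (suc i) + ℓ                           ∎
        where open ≡-Reasoning
      same-length : length (drop ds (word βi)) ≡ length (drop kk (word βm))
      same-length = +-cancelˡ-≡ (s + ℓ) _ _ (trans (trans (+-assoc s ℓ _) (trans (cong (s +_) (+-comm ℓ _))
                      (trans (sym (+-assoc s _ ℓ)) (cong (_+ ℓ) end-i)))) (sym end-m))

    -- If s + ℓ is inside block m, the block r places after m starts with the same kk letters.
    heads-agree : 1 ≤ kk → Σ Block λ β → bs !? (r + m) ≡ just β × take kk (word β) ≡ take kk (word βm)
    heads-agree 1≤kk = β , bs[r+m] , sym (occurs-unique (take kk (word βm)) (take kk (word β)) U (start bs (r + m))
        (trans (length-take-≤ kk (word βm) (<⇒≤ kk<βm)) (sym (length-take-≤ kk (word β) (<⇒≤ kk<β))))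
        (occurs-at (take kk (word βm)) U (sym end-of-square)
          (occurs-shift (take kk (word βm)) U square (<⇒≤ (s<start i<m))
            (≤-reflexive (trans (cong (start bs m +_) (length-take-≤ kk (word βm) (<⇒≤ kk<βm))) start-m+kk))
            (occurs-take (word βm) U (start bs m) kk (occurs-block bs m bs[m]))))
        (occurs-take (word β) U (start bs (r + m)) kk (occurs-block bs (r + m) bs[r+m])))
      where
      start-m<s+ℓ : start bs m < s + ℓ
      start-m<s+ℓ = subst (start bs m <_) start-m+kk (m<m+n (start bs m) 1≤kk)
      r+m<len : r + m < len
      r+m<len with r + m <? len
      ... | yes lt = lt
      ... | no  ≮  = ⊥-elim (<-irrefl (trans (sym end-of-square) (start-beyond bs (r + m) (≮⇒≥ ≮)))
                       (<-≤-trans (+-monoˡ-< ℓ start-m<s+ℓ) fits))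
      β : Block
      β = proj₁ (block-at (r + m) r+m<len)
      bs[r+m] : bs !? (r + m) ≡ just β
      bs[r+m] = proj₂ (block-at (r + m) r+m<len)
      s+ℓ≤start : s + ℓ ≤ start bs (r + m)
      s+ℓ≤start = subst (s + ℓ ≤_) (sym end-of-square) (+-monoˡ-≤ ℓ (<⇒≤ (s<start i<m)))
      far : s + ℓ + ℓ < start bs (suc (r + m))
      far = ≰⇒> λ end≤ → no-cut-between bs m (cut-unshift (≤-trans s+ℓ≤start (<⇒≤ (start-< (n<1+n _) r+m<len))) end≤ (cut-at (suc (r + m)) r+m<len))
              (subst (_< start bs (suc (r + m)) ∸ ℓ) (m+n∸n≡m (start bs m) ℓ)
                (∸-monoˡ-< (subst (_< start bs (suc (r + m))) end-of-square (start-< (n<1+n _) r+m<len)) (m≤n+m ℓ (start bs m))))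
              (≤-<-trans (subst (start bs (suc (r + m)) ∸ ℓ ≤_) (m+n∸n≡m (s + ℓ) ℓ) (∸-monoˡ-≤ ℓ end≤)) s+ℓ<end-m)
      kk<β : kk < length (word β)
      kk<β = +-cancelˡ-< (start bs (r + m)) kk _ (subst₂ _<_ s+2ℓ≡ (start-suc bs (r + m) bs[r+m]) far)
        where
        s+2ℓ≡ : s + ℓ + ℓ ≡ start bs (r + m) + kk
        s+2ℓ≡ = sym (trans (cong (_+ kk) end-of-square)
                  (trans (+-assoc (start bs m) ℓ kk) (trans (cong (start bs m +_) (+-comm ℓ kk))
                    (trans (sym (+-assoc (start bs m) kk ℓ)) (cong (_+ ℓ) start-m+kk)))))

    private
      M : List V
      M = map vertex bs

      index-i : ∀ t → i + suc t ≡ suc (t + i)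
      index-i t = trans (+-suc i t) (cong suc (+-comm i t))

      index-m : ∀ t → i + r + t ≡ t + m
      index-m t = trans (cong (_+ t) (trans (+-comm i r) r+i≡m)) (+-comm m t)

      from-i : vertex βi ≡ vertex βm → SquareAt M i r
      from-i same zero _ = trans (cong (M !?_) (+-identityʳ i))
                             (trans (vertex-at bs[i]) (trans (cong just same) (sym (trans (cong (M !?_) (index-m 0)) (vertex-at bs[m])))))
      from-i same (suc t) t< = trans (cong (M !?_) (index-i t))
                                 (trans (inner-vertices t t<) (sym (cong (M !?_) (index-m (suc t)))))

      from-suc-i : ∀ {β} → bs !? (r + m) ≡ just β → vertex β ≡ vertex βm → SquareAt M (suc i) r
      from-suc-i {β} bs[r+m] same t t< with m≤n⇒m<n∨m≡n t<
      ... | inj₁ st<r = trans (cong (M !?_) (cong suc (+-comm i t)))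
                          (trans (inner-vertices t st<r) (cong (M !?_) (cong suc (sym (index-m t)))))
      ... | inj₂ st≡r = begin
        M !? (suc i + t)      ≡⟨ cong (M !?_) (trans (cong suc (+-comm i t)) (trans (cong (_+ i) st≡r) r+i≡m)) ⟩
        M !? m                ≡⟨ vertex-at bs[m] ⟩
        just (vertex βm)      ≡⟨ cong just (sym same) ⟩
        just (vertex β)       ≡⟨ sym (vertex-at bs[r+m]) ⟩
        M !? (r + m)          ≡⟨ cong (M !?_) (sym (trans (cong suc (index-m t)) (cong (_+ m) st≡r))) ⟩
        M !? (suc i + r + t)  ∎
        where open ≡-Reasoning

    vertex-square : VertexSquare bs s ℓ
    vertex-square = [ from-suffix , from-prefix ]′ (boundary-determines-vertex βm kk (<⇒≤ kk<βm))
      where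
      from-suffix : (∀ β′ j → drop j (word β′) ≡ drop kk (word βm) → vertex β′ ≡ vertex βm) → VertexSquare bs s ℓ
      from-suffix by-suffix = record
        { first = i ; period = r ; period≥1 = r≥1 ; repeats = from-i (by-suffix βi ds tails-agree)
        ; inside = subst (_≤ len) (sym i+r+r≡) (proj₁ (shifted-block ≤-refl r≥1))
        ; anchor = i ; anchor≤first = ≤-refl ; s<anchor-end = s<end-i ; ends-in-square = ends-ε }

      from-prefix : (∀ β′ → take kk (word β′) ≡ take kk (word βm) → vertex β′ ≡ vertex βm) → VertexSquare bs s ℓ
      from-prefix by-prefix = [ nonempty , empty ]′ (toSum (1 ≤? kk))
        where
        nonempty : 1 ≤ kk → VertexSquare bs s ℓ
        nonempty 1≤kk = record
          { first = suc i ; period = r ; period≥1 = r≥1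
          ; repeats = from-suc-i (proj₁ (proj₂ next)) (by-prefix (proj₁ next) (proj₂ (proj₂ next)))
          ; inside = subst (_≤ len) (cong suc (sym i+r+r≡)) (!?-just⇒< bs (r + m) (proj₁ (proj₂ next)))
          ; anchor = i ; anchor≤first = n≤1+n i ; s<anchor-end = s<end-i ; ends-in-square = ends-ε }
          where
          next : Σ Block λ β → bs !? (r + m) ≡ just β × take kk (word β) ≡ take kk (word βm)
          next = heads-agree 1≤kk
        -- With kk = 0 the prefix test is vacuous, so it cannot single out a vertex.
        empty : ¬ 1 ≤ kk → VertexSquare bs s ℓ
        empty kk≱1 = ⊥-elim (pl-id≢pl-ab (trans (by-prefix (pl id , seedQ) (no-letters (pl id , seedQ))) (sym (by-prefix (pl ab , seedQ) (no-letters (pl ab , seedQ))))))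
          where
          pl-id≢pl-ab : pl id ≢ pl ab
          pl-id≢pl-ab ()
          no-letters : ∀ β → take kk (word β) ≡ take kk (word βm)
          no-letters β = subst (λ n → take n (word β) ≡ take n (word βm)) (sym (n<1⇒n≡0 (≰⇒> kk≱1))) refl


module Squares where

  open Positions
  open Blocks
  open BlockFacts
  open Factorisation word
  open ShortSquares
  open LongSquares
  open Circular
  open import Data.Nat using (ℕ; zero; suc; _+_; _∸_; _≤_; _<_; _≤?_; z≤n; s≤s)
  open import Data.Nat.Properties
  open import Data.List using (List; []; _∷_; _++_; map; length; last; concatMap)
  open import Data.List.Properties using (length-++; length-map; map-++; ++-assoc; ++-conicalˡ; ++-conicalʳ)
  open import Data.List.Membership.DecPropositional _≟V_ using (_∈?_)
  open import Data.List.Relation.Unary.All as All using (All; all?)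
  open import Data.List.Relation.Unary.Linked using (Linked; []; [-]; _∷_)
  open import Data.List.Relation.Unary.Linked.Properties using (++⁺)
  open import Data.Maybe using (just)
  open import Data.Maybe.Relation.Binary.Connected using (Connected; just)
  open import Data.Product using (Σ; _×_; _,_; proj₁; proj₂)
  open import Data.Empty using (⊥; ⊥-elim)
  open import Relation.Nullary using (yes; no; ¬_)
  open import Relation.Nullary.Decidable using (¬?)
  open import Relation.Binary.PropositionalEquality

  seed-of : ∀ {x A} → InDeltaLetter x A → Seed
  seed-of useQ  = seedQ
  seed-of useR  = seedR
  seed-of useQ' = seedQ′
  seed-of useR' = seedR′

  word-seed-of : ∀ {x A} (letter : InDeltaLetter x A) → word (x , seed-of letter) ≡ A
  word-seed-of useQ  = refl
  word-seed-of useR  = refl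
  word-seed-of useQ' = refl
  word-seed-of useR' = refl

  factorisation : ∀ {w W} → InDelta w W → Σ (List Block) λ bs → map vertex bs ≡ w × concatMap word bs ≡ W
  factorisation [] = [] , refl , refl
  factorisation (_∷_ {x} letter rest) with factorisation rest
  ... | bs , refl , refl = (x , seed-of letter) ∷ bs , refl , cong (_++ concatMap word bs) (word-seed-of letter)

  no-loop : ∀ x → ¬ Arc x x
  no-loop x = All.lookup (by-decision (all? (λ x → ¬? (x ∈? succs x)) vertices) refl) (∈-vertices x)

  chain-linked : ∀ {x₀ y} zs → ChainTo x₀ y zs → Linked Arc (y ∷ zs)
  chain-linked []       _            = [-]
  chain-linked (z ∷ zs) (arc , rest) = arc ∷ chain-linked zs rest

  chain-closes : ∀ {x₀ y} zs → ChainTo x₀ y zs → Connected Arc (last (y ∷ zs)) (just x₀)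
  chain-closes []       arc        = just arc
  chain-closes (z ∷ zs) (_ , rest) = chain-closes zs rest

  cube-linked : ∀ x₀ zs → Walkable (x₀ ∷ zs) → Linked Arc ((x₀ ∷ zs) ++ (x₀ ∷ zs) ++ (x₀ ∷ zs))
  cube-linked x₀ zs walk = ++⁺ once (chain-closes zs walk) (++⁺ once (chain-closes zs walk) once)
    where
    once : Linked Arc (x₀ ∷ zs)
    once = chain-linked zs walk

  module _ {w : List V} {W : Word} (n≥2 : 2 ≤ length w) (csf : CircSquareFree w) (walk : Linked Arc (w ++ w ++ w))
           (δ : InDelta w W) {u v x y z : Word} (W≡ : W ≡ u ++ v) (y≢[] : ¬ y ≡ [])
           (conjugate≡ : v ++ u ≡ x ++ y ++ y ++ z) where

    private
      n : ℕ
      n = length w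
      bs : List Block
      bs = proj₁ (factorisation δ)
      vertices≡ : map vertex bs ≡ w
      vertices≡ = proj₁ (proj₂ (factorisation δ))
      word≡ : concatMap word bs ≡ W
      word≡ = proj₂ (proj₂ (factorisation δ))
      length-bs : length bs ≡ n
      length-bs = trans (sym (length-map vertex bs)) (cong length vertices≡)

      bs³ : List Block
      bs³ = bs ++ bs ++ bs
      U : Word
      U = concatMap word bs³
      U≡ : U ≡ W ++ W ++ W
      U≡ = trans (concatMap-++ bs (bs ++ bs)) (trans (cong (concatMap word bs ++_) (concatMap-++ bs bs)) (cong (λ V → V ++ V ++ V) word≡))
      vertices³≡ : map vertex bs³ ≡ w ++ w ++ w
      vertices³≡ = trans (map-++ vertex bs (bs ++ bs)) (cong₂ _++_ vertices≡ (trans (map-++ vertex bs bs) (cong₂ _++_ vertices≡ vertices≡)))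
      length-bs³ : length bs³ ≡ n + (n + n)
      length-bs³ = trans (length-++ bs) (cong₂ _+_ length-bs (trans (length-++ bs) (cong₂ _+_ length-bs length-bs)))

      N : ℕ
      N = length W
      length-U : length U ≡ N + (N + N)
      length-U = trans (cong length U≡) (trans (length-++ W) (cong (N +_) (length-++ W)))

      s ℓ : ℕ
      s = length u + length x
      ℓ = length y
      ℓ≥1 : 1 ≤ ℓ
      ℓ≥1 = nonempty y y≢[]
        where
        nonempty : (ys : Word) → ¬ ys ≡ [] → 1 ≤ length ys
        nonempty []      ys≢[] = ⊥-elim (ys≢[] refl)
        nonempty (_ ∷ _) _     = s≤s z≤n

      C : Word
      C = v ++ u
      length-C : length C ≡ N
      length-C = trans (length-++ v) (trans (+-comm (length v) (length u)) (trans (sym (length-++ u)) (cong length (sym W≡))))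
      x+ℓ+ℓ≤C : length x + ℓ + ℓ ≤ length C
      x+ℓ+ℓ≤C = subst (length x + ℓ + ℓ ≤_) (sym (cong length conjugate≡))
                  (subst (length x + ℓ + ℓ ≤_) (sym (trans (length-++ x) (cong (length x +_) (trans (length-++ y) (cong (ℓ +_) (length-++ y))))))
                    (≤-trans (≤-reflexive (+-assoc (length x) ℓ ℓ)) (+-monoʳ-≤ (length x) (+-monoʳ-≤ ℓ (m≤m+n ℓ (length z))))))

      square : SquareAt U s ℓ
      square = square-into C U (subst (λ V → Occurs C V (length u)) (sym (trans U≡ (cong (λ V → V ++ V ++ V) W≡))) (occurs-conjugate u v))
                 x+ℓ+ℓ≤C (subst (λ X → SquareAt X (length x) ℓ) (sym conjugate≡) (square-in-middle x y z))

      x+ℓ+ℓ≤N : length x + ℓ + ℓ ≤ N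
      x+ℓ+ℓ≤N = subst (length x + ℓ + ℓ ≤_) length-C x+ℓ+ℓ≤C

      2ℓ≤N : ℓ + ℓ ≤ N
      2ℓ≤N = ≤-trans (m≤n+m (ℓ + ℓ) (length x)) (≤-trans (≤-reflexive (sym (+-assoc (length x) ℓ ℓ))) x+ℓ+ℓ≤N)
      u≤N : length u ≤ N
      u≤N = subst (length u ≤_) (sym (trans (cong length W≡) (length-++ u))) (m≤m+n (length u) (length v))
      end≤2N : s + ℓ + ℓ ≤ N + N
      end≤2N = ≤-trans (≤-reflexive (trans (+-assoc s ℓ ℓ) (+-assoc (length u) (length x) (ℓ + ℓ))))
                 (+-mono-≤ u≤N (≤-trans (≤-reflexive (sym (+-assoc (length x) ℓ ℓ))) x+ℓ+ℓ≤N))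
      fits : s + ℓ + ℓ ≤ length U
      fits = ≤-trans end≤2N (≤-trans (+-monoʳ-≤ N (m≤m+n N N)) (≤-reflexive (sym length-U)))

      start-period : ∀ j → j ≤ n + n → start bs³ (n + j) ≡ N + start bs³ j
      start-period j j≤ = begin
        start bs³ (n + j)                   ≡⟨ cong (λ k → start bs³ (k + j)) (sym length-bs) ⟩
        start bs³ (length bs + j)           ≡⟨ start-++ʳ bs (bs ++ bs) j ⟩
        length (concatMap word bs) + start (bs ++ bs) j ≡⟨ cong₂ _+_ (cong length word≡) (sym (start-++ˡ (bs ++ bs) bs j j≤bs²)) ⟩
        N + start ((bs ++ bs) ++ bs) j      ≡⟨ cong (λ bs′ → N + start bs′ j) (++-assoc bs bs bs) ⟩
        N + start bs³ j                     ∎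
        where
        open ≡-Reasoning
        j≤bs² : j ≤ length (bs ++ bs)
        j≤bs² = subst (j ≤_) (sym (trans (length-++ bs) (cong₂ _+_ length-bs length-bs))) j≤
      start-2n : start bs³ (n + n) ≡ N + N
      start-2n = trans (start-period n (m≤m+n n n)) (cong (N +_) (trans (cong (start bs³) (sym (+-identityʳ n)))
                   (trans (start-period 0 z≤n) (trans (cong (N +_) (start-zero bs³)) (+-identityʳ N)))))

      s<2N : s < N + N
      s<2N = <-≤-trans (≤-trans (m<m+n s ℓ≥1) (m≤m+n (s + ℓ) ℓ)) end≤2N

    short-impossible : ℓ ≤ 41 → ⊥
    short-impossible ℓ≤41 = no-short-square-in bs³ (subst (Linked Arc) (sym vertices³≡) walk) ℓ≥1 ℓ≤41 fits room square
      where
      room : ∀ i → start bs³ i ≤ s → suc (suc i) < length bs³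
      room i start≤s = subst (suc (suc i) <_) (sym length-bs³) (≤-trans (+-monoʳ-≤ 2 i<2n) (+-monoˡ-≤ (n + n) n≥2))
        where
        i<2n : i < n + n
        i<2n = ≰⇒> λ 2n≤i → <-irrefl refl (≤-<-trans (≤-trans (≤-reflexive (sym start-2n)) (≤-trans (start-mono bs³ 2n≤i) start≤s)) s<2N)

    long-impossible : 42 ≤ ℓ → ⊥
    long-impossible 42≤ℓ = no-short-square-in-cube w csf period≥1 2r≤n (subst (first + period + period ≤_) length-bs³ inside)
                             (subst (λ X → SquareAt X first period) vertices³≡ repeats)
      where
      open VertexSquare (vertex-square bs³ 42≤ℓ fits square)
      inside′ : first + period + period ≤ n + (n + n)
      inside′ = subst (first + period + period ≤_) length-bs³ inside
      -- A vertex square longer than w would force the square of W W W to be longer than W.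
      2r≤n : period + period ≤ n
      2r≤n = ≮⇒≥ λ n<2r → <-irrefl refl (≤-<-trans (too-far n<2r) (beyond n<2r))
        where
        shifted≤ : n < period + period → n + suc anchor ≤ anchor + period + period
        shifted≤ n<2r = ≤-trans (≤-reflexive (trans (+-comm n (suc anchor)) (sym (+-suc anchor n))))
                          (≤-trans (+-monoʳ-≤ anchor n<2r) (≤-reflexive (sym (+-assoc anchor period period))))
        anchor< : n < period + period → suc anchor ≤ n + n
        anchor< n<2r = +-cancelˡ-≤ n _ _ (≤-trans (shifted≤ n<2r)
                         (≤-trans (+-monoˡ-≤ period (+-monoˡ-≤ period anchor≤first)) inside′))
        too-far : n < period + period → N + start bs³ (suc anchor) ≤ s + ℓ + ℓ
        too-far n<2r = ≤-trans (≤-reflexive (sym (start-period (suc anchor) (anchor< n<2r))))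
                         (≤-trans (start-mono bs³ (shifted≤ n<2r)) ends-in-square)
        beyond : n < period + period → s + ℓ + ℓ < N + start bs³ (suc anchor)
        beyond _ = ≤-<-trans (≤-trans (≤-reflexive (+-assoc s ℓ ℓ)) (≤-trans (+-monoʳ-≤ s 2ℓ≤N) (≤-reflexive (+-comm s N))))
                     (+-monoʳ-< N s<anchor-end)

    squares-impossible : ⊥
    squares-impossible with ℓ ≤? 41
    ... | yes ℓ≤41 = short-impossible ℓ≤41
    ... | no  ℓ≰41 = long-impossible (≰⇒> ℓ≰41)


open Squares using (no-loop; cube-linked; squares-impossible)

[]-square-free : {A : Set} → SquareFree {A} []
[]-square-free x y z y≢[] []≡ = y≢[] (++-conicalˡ y _ (++-conicalʳ x _ (sym []≡)))

lemma13 : (w : List V) (W : Defs.Word) →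
    CircSquareFree w → Walkable w → InDelta w W → CircSquareFree W
lemma13 []               W csf walk []    u v []≡ =
  subst SquareFree (sym (cong₂ _++_ (++-conicalʳ u v (sym []≡)) (++-conicalˡ u v (sym []≡)))) []-square-free
lemma13 (x₀ ∷ [])        W csf walk δ     = ⊥-elim (no-loop x₀ walk)
lemma13 (x₀ ∷ x₁ ∷ rest) W csf walk δ u v W≡ x y z y≢[] conjugate≡ =
  squares-impossible (s≤s (s≤s z≤n)) csf (cube-linked x₀ (x₁ ∷ rest) walk) δ {u} {v} {x} {y} {z} W≡ y≢[] conjugate≡
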